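{- Let $G=(V,E)$ be a finite connected simple graph on $n$ vertices, let $C\subseteq V$ with $|C|=r$, and let $2\le k<r$. Let $\mathbf{S}_C$ be a uniformly random $k$-element subset of $C$ and $\mathbf{S}_V$ a uniformly random $k$-element subset of $V$. (a) If $$\frac{r-k}{r-1}\,\overline{\deg}(C)>\frac{n-k}{n-1}\,\overline{\deg}(V),$$ then $\mathbb{E}\big(|G^\beta(\mathbf{S}_C)|\big)>\mathbb{E}\big(|G^\beta(\mathbf{S}_V)|\big)$ for all $\beta>0$ sufficiently close to $0$. (b) If $G$ has property $(*)$ and $$\frac{|Y\cap C|}{r}<\frac{|Y|}{n},$$ where $Y$ is the set of vertices of minimum degree, then $\mathbb{E}\big(|G^\beta(\mathbf{S}_C)|\big)<\mathbb{E}\big(|G^\beta(\mathbf{S}_V)|\big)$ for all $\beta<1$ sufficiently close to $1$.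
   Context: For $0\le\beta\le1$, $G^\beta$ denotes the random spanning subgraph of $G$ obtained by keeping each edge independently with probability $\beta$. For $S\subseteq V$, $G^\beta(S)$ is the union of the connected components of $G^\beta$ meeting $S$, and $|G^\beta(S)|$ its number of vertices. The random seed set and the percolation are independent, and $\mathbb{E}$ denotes expectation over both. For $K\subseteq V$, $\overline{\deg}(K)=\frac{1}{|K|}\sum_{v\in K}\deg(v)$. Property $(*)$: $G$ has minimum degree $d$, $G$ is not $d$-regular, and the only edge-cuts of $G$ consisting of at most $d$ edges are the sets of edges incident to a single vertex of degree $d$.
   Formalization: The percolation parameter β ranges over the rationals in both conclusions (a) and (b). -}

module Defs where

open import Data.Nat as ℕ using (ℕ; zero; suc)
open import Data.Fin using (Fin; toℕ)
open import Data.Fin.Subset using (Subset; ∣_∣; _⊆_; _∩_; ⁅_⁆; Nonempty; ⊤; ⊥)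
open import Data.Bool using (Bool; true; false; _∧_; _∨_; _xor_; if_then_else_)
open import Data.Vec using (Vec; []; _∷_; lookup; tabulate)
open import Data.List using (List; []; _∷_; map; filter; length; concatMap; allFin; foldr)
open import Data.Bool.ListAction using (any)
open import Data.Product using (_×_; _,_; Σ; ∃)
open import Data.Integer using (+_)
open import Data.Rational using (ℚ; 0ℚ; 1ℚ; _+_; _*_; _-_; _/_)
open import Relation.Binary.PropositionalEquality using (_≡_)
open import Relation.Nullary using (¬_)
open import Data.Fin.Properties using (_≟_)
open import Relation.Nullary.Decidable using (⌊_⌋)

record Graph (n : ℕ) : Set where
  field
    adj   : Fin n → Fin n → Bool
    sym   : ∀ i j → adj i j ≡ adj j i
    irrefl : ∀ i → adj i i ≡ false
open Graph public

data Walk {n : ℕ} (G : Graph n) : Fin n → Fin n → Set where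
  here : ∀ {u} → Walk G u u
  step : ∀ {u v w} → adj G u v ≡ true → Walk G v w → Walk G u w

Connected : ∀ {n} → Graph n → Set
Connected G = ∀ u v → Walk G u v

count : ∀ {n} → (Fin n → Bool) → ℕ
count {n} p = length (filter (λ i → Data.Bool.T? (p i)) (allFin n))
  where import Data.Bool

deg : ∀ {n} → Graph n → Fin n → ℕ
deg G v = count (adj G v)

sumℕ : List ℕ → ℕ
sumℕ = foldr ℕ._+_ 0

-- fraction a / b in ℚ; only used with b ≠ 0 (returns 0 for b = 0)
frac : ℕ → ℕ → ℚ
frac a zero    = 0ℚ
frac a (suc b) = + a / suc b

avgDeg : ∀ {n} → Graph n → Subset n → ℚ
avgDeg {n} G K = frac (sumℕ (map (λ v → if lookup K v then deg G v else 0) (allFin n))) ∣ K ∣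

-- edges (unordered, listed as pairs (i , j) with i < j)

Edge : ℕ → Set
Edge n = Fin n × Fin n

edges : ∀ {n} → Graph n → List (Edge n)
edges {n} G =
  concatMap (λ i → map (λ j → (i , j))
    (filter (λ j → Data.Nat.Properties._<?_ (toℕ i) (toℕ j) Relation.Nullary.×-dec Data.Bool.T? (adj G i j)) (allFin n)))
    (allFin n)
  where import Data.Bool; import Data.Nat.Properties; import Relation.Nullary

record Config (n : ℕ) : Set where
  constructor cfg
  field
    kept    : List (Edge n)
    nKept   : ℕ
    nLost   : ℕ

configs : ∀ {n} → List (Edge n) → List (Config n)
configs []       = cfg [] 0 0 ∷ []
configs (e ∷ es) = concatMap (λ c → cfg (e ∷ Config.kept c) (suc (Config.nKept c)) (Config.nLost c)
                                  ∷ cfg (Config.kept c) (Config.nKept c) (suc (Config.nLost c)) ∷ [])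
                             (configs es)

-- the vertex set of the components of the spanning subgraph (V , K)
-- meeting S: closure of S under the kept edges.  One step adds all
-- K-neighbours; n steps suffice (any path in a component has < n edges).

eqF : ∀ {n} → Fin n → Fin n → Bool
eqF i j = ⌊ i ≟ j ⌋

growStep : ∀ {n} → List (Edge n) → Subset n → Subset n
growStep K X = tabulate (λ v → lookup X v ∨
  any (λ { (a , b) → (eqF a v ∧ lookup X b) ∨ (eqF b v ∧ lookup X a) }) K)

iter : ∀ {A : Set} → ℕ → (A → A) → A → A
iter zero    f x = x
iter (suc m) f x = f (iter m f x)

componentsMeeting : ∀ {n} → List (Edge n) → Subset n → Subset n
componentsMeeting {n} K S = iter n (growStep K) S

_^ℚ_ : ℚ → ℕ → ℚ
x ^ℚ zero  = 1ℚ
x ^ℚ suc m = x * (x ^ℚ m)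

sumℚ : List ℚ → ℚ
sumℚ = foldr _+_ 0ℚ

fromℕ : ℕ → ℚ
fromℕ m = + m / 1

expectedSizeFixed : ∀ {n} → Graph n → ℚ → Subset n → ℚ
expectedSizeFixed G β S =
  sumℚ (map (λ c → (β ^ℚ Config.nKept c) * ((1ℚ - β) ^ℚ Config.nLost c)
                     * fromℕ ∣ componentsMeeting (Config.kept c) S ∣)
            (configs (edges G)))

allSubsets : ∀ n → List (Subset n)
allSubsets zero    = [] ∷ []
allSubsets (suc n) = concatMap (λ s → (true ∷ s) ∷ (false ∷ s) ∷ []) (allSubsets n)

kSubsetsOf : ∀ {n} → ℕ → Subset n → List (Subset n)
kSubsetsOf {n} k C =
  filter (λ S → Data.Nat.Properties._≟_ ∣ S ∣ k Relation.Nullary.×-dec Data.Fin.Subset.Properties._⊆?_ S C)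
         (allSubsets n)
  where import Data.Nat.Properties; import Relation.Nullary; import Data.Fin.Subset.Properties

average : List ℚ → ℚ
average xs = sumℚ xs * frac 1 (length xs)

-- E |G^β(S_C)| with S_C uniform among the k-subsets of C (independent of percolation)
expectedSize : ∀ {n} → Graph n → ℚ → ℕ → Subset n → ℚ
expectedSize G β k C = average (map (expectedSizeFixed G β) (kSubsetsOf k C))

crosses : ∀ {n} → Subset n → Fin n → Fin n → Bool
crosses X i j = lookup X i xor lookup X j

cutSize : ∀ {n} → Graph n → Subset n → ℕ
cutSize G X = length (filter (λ { (i , j) → Data.Bool.T? (crosses X i j) }) (edges G))
  where import Data.Bool

IsMinDegree : ∀ {n} → Graph n → ℕ → Set
IsMinDegree {n} G d = (∃ λ v → deg G v ≡ d) × (∀ v → d ℕ.≤ deg G v)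

Property* : ∀ {n} → Graph n → ℕ → Set
Property* {n} G d =
  IsMinDegree G d ×
  (∃ λ v → ¬ deg G v ≡ d) ×
  (∀ (X : Subset n) → Nonempty X → Nonempty (Data.Fin.Subset.∁ X) → cutSize G X ℕ.≤ d →
     ∃ λ v → deg G v ≡ d ×
       (∀ i j → adj G i j ≡ true → crosses X i j ≡ crosses ⁅ v ⁆ i j))

minDegSet : ∀ {n} → Graph n → ℕ → Subset n
minDegSet G d = tabulate (λ v → ⌊ Data.Nat.Properties._≟_ (deg G v) d ⌋)
  where import Data.Nat.Properties

{-# OPTIONS --safe #-}
-- Summing over the sets K of kept edges,
--   E|G^β(S_C)| - E|G^β(S_V)| = Σ_K β^|K| (1 - β)^|E∖K| g(K),
-- where g(K) is the difference of the average number of vertices of (V , K) reachable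
-- from a random k-subset of C and of V.  Such a sum is positive for small x = β
-- (resp. x = 1 - β) once all terms of x-degree below some j vanish and the terms of
-- x-degree j have positive total coefficient.
-- (a) j = 1 kept edge: g(∅) = 0, and one edge uv adds P(exactly one of u, v is a seed);
--     summed over the edges this is k((r-k)/(r-1) deg(C) - (n-k)/(n-1) deg(V)) plus a
--     nonnegative term that vanishes for C = V.
-- (b) j = d lost edges: while at most d edges are lost, the vertices outside the cluster
--     of the seeds span a cut of at most d edges, so by (*) they are at most one isolated
--     vertex.  Hence g vanishes below d losses, and with exactly d losses it only sees the
--     minimum-degree vertices whose whole star is lost, giving k(|Y|/n - |Y ∩ C|/r).
module Submission where

open import Defs renaming (sym to gsym)
open import Data.Nat as ℕ using (ℕ; zero; suc; _≡ᵇ_; _∸_)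
import Data.Nat.Properties as ℕP
import Data.Nat.Solver as ℕ-Solver
import Data.Integer as ℤ
import Data.Integer.Properties as ℤP
open import Data.Rational as Q using (ℚ; 0ℚ; 1ℚ; _+_; _*_; _-_; -_; toℚᵘ)
import Data.Rational.Properties as QP
open import Data.Rational.Unnormalised as U using (mkℚᵘ; *≡*; *≤*; *<*)
import Data.Rational.Unnormalised.Properties as UP
open import Data.List using (List; []; _∷_; map; filter; length; concatMap; allFin; _++_)
import Data.List.Properties as LP
open import Data.List.Relation.Unary.All as All using (All; []; _∷_)
open import Data.List.Relation.Unary.All.Properties using (map⁺; all-filter; ++⁺)
open import Data.List.Relation.Unary.Any as Any using (Any; here; there)
open import Data.List.Membership.Propositional using (_∈_)
open import Data.List.Membership.Propositional.Properties using (∈-allFin)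
open import Data.Vec using ([]; _∷_; lookup; tabulate)
import Data.Vec.Properties as VP
open import Data.Fin using (Fin; zero; suc; toℕ)
import Data.Fin.Properties as FP
open import Data.Fin.Subset using (Subset; ∣_∣; _⊆_; _∩_; _∪_; ⁅_⁆; ⊤; ⊥; ∁; Nonempty)
open import Data.Fin.Subset.Properties using (_⊆?_; ∣⁅x⁆∣≡1; ∪-identityˡ; ∪-identityʳ; ∣⊤∣≡n; ∣⊥∣≡0; ∣p∣≤n)
open import Data.Bool using (Bool; true; false; if_then_else_; _∧_; _∨_; not; _xor_; T)
import Data.Bool as B
import Data.Bool.Properties as BP
open import Data.Bool.ListAction using (any)
open import Data.Product using (_×_; _,_; proj₁; proj₂; ∃)
open import Data.Sum using (_⊎_; inj₁; inj₂)
open import Data.Empty using (⊥-elim)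
open import Relation.Nullary using (¬_; does; yes; no; _×-dec_)
open import Relation.Nullary.Decidable using (⌊_⌋; dec-true; dec-false)
open import Relation.Unary using (Pred; Decidable)
open import Relation.Binary.PropositionalEquality
open import Relation.Binary.Definitions using (tri<; tri≈; tri>)
open import Function using (_∘_; id)

binom : ℕ → ℕ → ℕ
binom n zero = 1
binom zero (suc k) = 0
binom (suc n) (suc k) = binom n k ℕ.+ binom n (suc k)

binom-1 : ∀ m → binom m 1 ≡ m
binom-1 zero = refl
binom-1 (suc m) = cong suc (binom-1 m)

binom-absorption : ∀ r k → suc k ℕ.* binom (suc r) (suc k) ≡ suc r ℕ.* binom r k
binom-absorption zero zero = refl
binom-absorption zero (suc k) = ℕP.*-zeroʳ (suc (suc k))
binom-absorption (suc r) zero rewrite binom-1 r = cong suc (trans (ℕP.+-identityʳ _) (sym (ℕP.*-identityʳ _)))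
binom-absorption (suc r) (suc k) = begin
  suc (suc k) ℕ.* (binom (suc r) (suc k) ℕ.+ binom (suc r) (suc (suc k)))
    ≡⟨ solve 3 (λ k a b → (con 2 :+ k) :* (a :+ b) := ((con 1 :+ k) :* a :+ a) :+ (con 2 :+ k) :* b) refl k (binom (suc r) (suc k)) (binom (suc r) (suc (suc k))) ⟩
  (suc k ℕ.* binom (suc r) (suc k) ℕ.+ binom (suc r) (suc k)) ℕ.+ suc (suc k) ℕ.* binom (suc r) (suc (suc k))
    ≡⟨ cong₂ (λ u v → (u ℕ.+ binom (suc r) (suc k)) ℕ.+ v) (binom-absorption r k) (binom-absorption r (suc k)) ⟩
  (suc r ℕ.* binom r k ℕ.+ binom (suc r) (suc k)) ℕ.+ suc r ℕ.* binom r (suc k)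
    ≡⟨ solve 3 (λ r a b → ((con 1 :+ r) :* a :+ (a :+ b)) :+ (con 1 :+ r) :* b := (con 2 :+ r) :* (a :+ b)) refl r (binom r k) (binom r (suc k)) ⟩
  suc (suc r) ℕ.* binom (suc r) (suc k) ∎
  where open ≡-Reasoning
        open ℕ-Solver.+-*-Solver

open import Data.Rational.Solver
open +-*-Solver

toℚᵘ-frac : ∀ a b → toℚᵘ (frac a (suc b)) U.≃ mkℚᵘ (ℤ.+ a) b
toℚᵘ-frac a b = QP.toℚᵘ-fromℚᵘ (mkℚᵘ (ℤ.+ a) b)

fromℕ-+ : ∀ a b → fromℕ (a ℕ.+ b) ≡ fromℕ a + fromℕ b
fromℕ-+ a b = QP.toℚᵘ-injective (UP.≃-trans (toℚᵘ-frac (a ℕ.+ b) 0)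
  (UP.≃-trans (UP.≃-trans e (UP.≃-sym (UP.+-cong (toℚᵘ-frac a 0) (toℚᵘ-frac b 0))))
              (UP.≃-sym (QP.toℚᵘ-homo-+ (fromℕ a) (fromℕ b)))))
  where
  e : mkℚᵘ (ℤ.+ (a ℕ.+ b)) 0 U.≃ (mkℚᵘ (ℤ.+ a) 0 U.+ mkℚᵘ (ℤ.+ b) 0)
  e = *≡* (begin
      ℤ.+ (a ℕ.+ b) ℤ.* ℤ.+ 1 ≡⟨ ℤP.*-identityʳ _ ⟩
      ℤ.+ (a ℕ.+ b) ≡⟨ ℤP.pos-+ a b ⟩
      ℤ.+ a ℤ.+ ℤ.+ b ≡⟨ sym (cong₂ ℤ._+_ (ℤP.*-identityʳ (ℤ.+ a)) (ℤP.*-identityʳ (ℤ.+ b))) ⟩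
      (ℤ.+ a ℤ.* ℤ.+ 1 ℤ.+ ℤ.+ b ℤ.* ℤ.+ 1) ≡⟨ sym (ℤP.*-identityʳ _) ⟩
      (ℤ.+ a ℤ.* ℤ.+ 1 ℤ.+ ℤ.+ b ℤ.* ℤ.+ 1) ℤ.* ℤ.+ 1 ∎)
    where open ≡-Reasoning

fromℕ-* : ∀ a b → fromℕ (a ℕ.* b) ≡ fromℕ a * fromℕ b
fromℕ-* a b = QP.toℚᵘ-injective (UP.≃-trans (toℚᵘ-frac (a ℕ.* b) 0)
  (UP.≃-trans (UP.≃-trans e (UP.≃-sym (UP.*-cong (toℚᵘ-frac a 0) (toℚᵘ-frac b 0))))
              (UP.≃-sym (QP.toℚᵘ-homo-* (fromℕ a) (fromℕ b)))))
  where
  e : mkℚᵘ (ℤ.+ (a ℕ.* b)) 0 U.≃ (mkℚᵘ (ℤ.+ a) 0 U.* mkℚᵘ (ℤ.+ b) 0)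
  e = *≡* (begin
      ℤ.+ (a ℕ.* b) ℤ.* ℤ.+ 1 ≡⟨ ℤP.*-identityʳ _ ⟩
      ℤ.+ (a ℕ.* b) ≡⟨ ℤP.pos-* a b ⟩
      ℤ.+ a ℤ.* ℤ.+ b ≡⟨ sym (ℤP.*-identityʳ _) ⟩
      (ℤ.+ a ℤ.* ℤ.+ b) ℤ.* ℤ.+ 1 ∎)
    where open ≡-Reasoning

frac*den≡num : ∀ a b → frac a (suc b) * fromℕ (suc b) ≡ fromℕ a
frac*den≡num a b = QP.toℚᵘ-injective (UP.≃-trans (QP.toℚᵘ-homo-* (frac a (suc b)) (fromℕ (suc b)))
  (UP.≃-trans (UP.*-cong (toℚᵘ-frac a b) (toℚᵘ-frac (suc b) 0)) (UP.≃-trans e (UP.≃-sym (toℚᵘ-frac a 0)))))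
  where
  e : (mkℚᵘ (ℤ.+ a) b U.* mkℚᵘ (ℤ.+ suc b) 0) U.≃ mkℚᵘ (ℤ.+ a) 0
  e = *≡* (begin
      (ℤ.+ a ℤ.* ℤ.+ suc b) ℤ.* ℤ.+ 1 ≡⟨ ℤP.*-identityʳ _ ⟩
      ℤ.+ a ℤ.* ℤ.+ suc b ≡⟨ cong (λ z → ℤ.+ a ℤ.* ℤ.+ z) (sym (ℕP.*-identityʳ (suc b))) ⟩
      ℤ.+ a ℤ.* ℤ.+ (suc b ℕ.* 1) ∎)
    where open ≡-Reasoning

fromℕ-mono-≤ : ∀ {a b} → a ℕ.≤ b → fromℕ a Q.≤ fromℕ b
fromℕ-mono-≤ {a} {b} p = QP.toℚᵘ-cancel-≤ (UP.≤-respʳ-≃ (UP.≃-sym (toℚᵘ-frac b 0)) (UP.≤-respˡ-≃ (UP.≃-sym (toℚᵘ-frac a 0))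
  (*≤* (subst₂ ℤ._≤_ (sym (ℤP.*-identityʳ (ℤ.+ a))) (sym (ℤP.*-identityʳ (ℤ.+ b))) (ℤ.+≤+ p)))))

fromℕ-mono-< : ∀ {a b} → a ℕ.< b → fromℕ a Q.< fromℕ b
fromℕ-mono-< {a} {b} p = QP.toℚᵘ-cancel-< (UP.<-respʳ-≃ (UP.≃-sym (toℚᵘ-frac b 0)) (UP.<-respˡ-≃ (UP.≃-sym (toℚᵘ-frac a 0))
  (*<* (subst₂ ℤ._<_ (sym (ℤP.*-identityʳ (ℤ.+ a))) (sym (ℤP.*-identityʳ (ℤ.+ b))) (ℤ.+<+ p)))))

p≤q⇒0≤q-p : ∀ {a b} → a Q.≤ b → 0ℚ Q.≤ b - a
p≤q⇒0≤q-p {a} {b} p = subst (Q._≤ b - a) (QP.+-inverseʳ a) (QP.+-monoˡ-≤ (- a) p)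

p<q⇒0<q-p : ∀ {a b} → a Q.< b → 0ℚ Q.< b - a
p<q⇒0<q-p {a} {b} p = subst (Q._< b - a) (QP.+-inverseʳ a) (QP.+-monoˡ-< (- a) p)

0≤q-p⇒p≤q : ∀ {a b} → 0ℚ Q.≤ b - a → a Q.≤ b
0≤q-p⇒p≤q {a} {b} p = subst₂ Q._≤_ (QP.+-identityˡ a) (solve 2 (λ a b → (b :- a) :+ a := b) refl a b) (QP.+-monoˡ-≤ a p)

0<q-p⇒p<q : ∀ {a b} → 0ℚ Q.< b - a → a Q.< b
0<q-p⇒p<q {a} {b} p = subst₂ Q._<_ (QP.+-identityˡ a) (solve 2 (λ a b → (b :- a) :+ a := b) refl a b) (QP.+-monoˡ-< a p)

+-nonneg : ∀ {a b} → 0ℚ Q.≤ a → 0ℚ Q.≤ b → 0ℚ Q.≤ a + b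
+-nonneg p q = QP.+-mono-≤ p q


*-nonneg : ∀ {a b} → 0ℚ Q.≤ a → 0ℚ Q.≤ b → 0ℚ Q.≤ a * b
*-nonneg {a} {b} p q = QP.nonNegative⁻¹ (a * b) {{QP.nonNeg*nonNeg⇒nonNeg a {{Q.nonNegative p}} b {{Q.nonNegative q}}}}

*-pos : ∀ {a b} → 0ℚ Q.< a → 0ℚ Q.< b → 0ℚ Q.< a * b
*-pos {a} {b} p q = QP.positive⁻¹ (a * b) {{QP.pos*pos⇒pos a {{Q.positive p}} b {{Q.positive q}}}}

*-monoʳ-≤-0≤ : ∀ {c a b} → 0ℚ Q.≤ c → a Q.≤ b → c * a Q.≤ c * b
*-monoʳ-≤-0≤ {c} {a} {b} h p = 0≤q-p⇒p≤q (subst (0ℚ Q.≤_) (solve 3 (λ c a b → c :* (b :- a) := c :* b :- c :* a) refl c a b) (*-nonneg h (p≤q⇒0≤q-p p)))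

fromℕ-nonneg : ∀ a → 0ℚ Q.≤ fromℕ a
fromℕ-nonneg a = fromℕ-mono-≤ {0} {a} ℕ.z≤n

fromℕ-suc-pos : ∀ a → 0ℚ Q.< fromℕ (suc a)
fromℕ-suc-pos a = fromℕ-mono-< {0} {suc a} (ℕ.s≤s ℕ.z≤n)

*-cancelʳ-fromℕ-suc : ∀ {x y} b → x * fromℕ (suc b) ≡ y * fromℕ (suc b) → x ≡ y
*-cancelʳ-fromℕ-suc {x} {y} b e = begin
  x ≡⟨ solve 1 (λ x → x := x :* con 1ℚ) refl x ⟩
  x * 1ℚ ≡⟨ cong (x *_) (sym (frac*den≡num 1 b)) ⟩
  x * (f * i) ≡⟨ solve 3 (λ x f i → x :* (f :* i) := (x :* i) :* f) refl x f i ⟩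
  (x * i) * f ≡⟨ cong (_* f) e ⟩
  (y * i) * f ≡⟨ solve 3 (λ x f i → (x :* i) :* f := x :* (f :* i)) refl y f i ⟩
  y * (f * i) ≡⟨ cong (y *_) (frac*den≡num 1 b) ⟩
  y * 1ℚ ≡⟨ solve 1 (λ x → x :* con 1ℚ := x) refl y ⟩
  y ∎
  where open ≡-Reasoning
        f = frac 1 (suc b)
        i = fromℕ (suc b)

frac≡num*frac1 : ∀ a b → frac a (suc b) ≡ fromℕ a * frac 1 (suc b)
frac≡num*frac1 a b = *-cancelʳ-fromℕ-suc b (trans (frac*den≡num a b) (sym (trans (QP.*-assoc (fromℕ a) _ _) (trans (cong (fromℕ a *_) (frac*den≡num 1 b)) (QP.*-identityʳ _)))))

fromℕ*frac1≡1 : ∀ {m} → 0 ℕ.< m → fromℕ m * frac 1 m ≡ 1ℚ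
fromℕ*frac1≡1 {suc m} _ = trans (QP.*-comm (fromℕ (suc m)) (frac 1 (suc m))) (frac*den≡num 1 m)

fromℕ-cancel-≤ : ∀ {a b} → fromℕ a Q.≤ fromℕ b → a ℕ.≤ b
fromℕ-cancel-≤ h = ℕP.≮⇒≥ (λ lt → QP.<-irrefl refl (QP.<-≤-trans (fromℕ-mono-< lt) h))

fromℕ-injective : ∀ {a b} → fromℕ a ≡ fromℕ b → a ≡ b
fromℕ-injective {a} {b} e with ℕP.<-cmp a b
... | tri< lt _ _ = ⊥-elim (QP.<-irrefl e (fromℕ-mono-< lt))
... | tri≈ _ eq _ = eq
... | tri> _ _ gt = ⊥-elim (QP.<-irrefl (sym e) (fromℕ-mono-< gt))

ind : Bool → ℚ
ind b = if b then 1ℚ else 0ℚ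

ind≥0 : ∀ b → 0ℚ Q.≤ ind b
ind≥0 true = QP.<⇒≤ (fromℕ-suc-pos 0)
ind≥0 false = QP.≤-refl

Σ : ∀ {A : Set} → List A → (A → ℚ) → ℚ
Σ xs f = sumℚ (map f xs)

sum-+ : ∀ {A : Set} (xs : List A) f g → Σ xs (λ x → f x + g x) ≡ Σ xs f + Σ xs g
sum-+ [] f g = refl
sum-+ (x ∷ xs) f g rewrite sum-+ xs f g =
  solve 4 (λ a b c d → (a :+ b) :+ (c :+ d) := (a :+ c) :+ (b :+ d)) refl (f x) (g x) (Σ xs f) (Σ xs g)

sum-*ˡ : ∀ {A : Set} (xs : List A) c f → Σ xs (λ x → c * f x) ≡ c * Σ xs f
sum-*ˡ [] c f = solve 1 (λ c → con 0ℚ := c :* con 0ℚ) refl c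
sum-*ˡ (x ∷ xs) c f rewrite sum-*ˡ xs c f = solve 3 (λ c a b → c :* a :+ c :* b := c :* (a :+ b)) refl c (f x) (Σ xs f)

sum-*ʳ : ∀ {A : Set} (xs : List A) c f → Σ xs (λ x → f x * c) ≡ Σ xs f * c
sum-*ʳ [] c f = solve 1 (λ c → con 0ℚ := con 0ℚ :* c) refl c
sum-*ʳ (x ∷ xs) c f rewrite sum-*ʳ xs c f = solve 3 (λ c a b → a :* c :+ b :* c := (a :+ b) :* c) refl c (f x) (Σ xs f)

sum-neg : ∀ {A : Set} (xs : List A) f → Σ xs (λ x → - f x) ≡ - Σ xs f
sum-neg [] f = refl
sum-neg (x ∷ xs) f rewrite sum-neg xs f = solve 2 (λ a b → (:- a) :+ (:- b) := :- (a :+ b)) refl (f x) (Σ xs f)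

sum-- : ∀ {A : Set} (xs : List A) f g → Σ xs (λ x → f x - g x) ≡ Σ xs f - Σ xs g
sum-- xs f g = trans (sum-+ xs f (λ x → - g x)) (cong (Σ xs f +_) (sum-neg xs g))

sum-0 : ∀ {A : Set} (xs : List A) → Σ xs (λ _ → 0ℚ) ≡ 0ℚ
sum-0 [] = refl
sum-0 (x ∷ xs) rewrite sum-0 xs = refl

sum-cong : ∀ {A : Set} (xs : List A) {f g} → (∀ x → f x ≡ g x) → Σ xs f ≡ Σ xs g
sum-cong [] e = refl
sum-cong (x ∷ xs) e = cong₂ _+_ (e x) (sum-cong xs e)

sum-congAll : ∀ {A : Set} {xs : List A} {f g} → All (λ x → f x ≡ g x) xs → Σ xs f ≡ Σ xs g
sum-congAll [] = refl
sum-congAll (e ∷ es) = cong₂ _+_ e (sum-congAll es)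

sum-mono : ∀ {A : Set} {xs : List A} {f g} → All (λ x → f x Q.≤ g x) xs → Σ xs f Q.≤ Σ xs g
sum-mono [] = QP.≤-refl
sum-mono (e ∷ es) = QP.+-mono-≤ e (sum-mono es)

sum-map : ∀ {A B : Set} (xs : List A) (g : A → B) f → Σ (map g xs) f ≡ Σ xs (f ∘ g)
sum-map xs g f = cong sumℚ (sym (LP.map-∘ xs))

sum-++ : ∀ {A : Set} (xs ys : List A) f → Σ (xs ++ ys) f ≡ Σ xs f + Σ ys f
sum-++ [] ys f = sym (QP.+-identityˡ _)
sum-++ (x ∷ xs) ys f rewrite sum-++ xs ys f = sym (QP.+-assoc (f x) _ _)

sum-concatMap : ∀ {A B : Set} (xs : List A) (g : A → List B) f → Σ (concatMap g xs) f ≡ Σ xs (λ x → Σ (g x) f)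
sum-concatMap [] g f = refl
sum-concatMap (x ∷ xs) g f = trans (sum-++ (g x) (concatMap g xs) f) (cong (Σ (g x) f +_) (sum-concatMap xs g f))

sum-filter : ∀ {A : Set} {p} {P : Pred A p} (P? : Decidable P) (xs : List A) f →
  Σ (filter P? xs) f ≡ Σ xs (λ x → if does (P? x) then f x else 0ℚ)
sum-filter P? [] f = refl
sum-filter P? (x ∷ xs) f with does (P? x)
... | true = cong (f x +_) (sum-filter P? xs f)
... | false = trans (sum-filter P? xs f) (sym (QP.+-identityˡ (Σ xs (λ x → if does (P? x) then f x else 0ℚ))))

sum-swap : ∀ {A B : Set} (xs : List A) (ys : List B) (f : A → B → ℚ) →
  Σ xs (λ x → Σ ys (λ y → f x y)) ≡ Σ ys (λ y → Σ xs (λ x → f x y))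
sum-swap {A} {B} [] ys f = sym (sum-0 ys)
sum-swap (x ∷ xs) ys f = trans (cong (λ z → Σ ys (f x) + z) (sum-swap xs ys f)) (sym (sum-+ ys (f x) (λ y → Σ xs (λ x → f x y))))

sum-const : ∀ {A : Set} (xs : List A) c → Σ xs (λ _ → c) ≡ fromℕ (length xs) * c
sum-const [] c = solve 1 (λ c → con 0ℚ := con 0ℚ :* c) refl c
sum-const (x ∷ xs) c = begin
  c + Σ xs (λ _ → c)             ≡⟨ cong (c +_) (sum-const xs c) ⟩
  c + fromℕ (length xs) * c      ≡⟨ solve 2 (λ c l → c :+ l :* c := (con 1ℚ :+ l) :* c) refl c (fromℕ (length xs)) ⟩
  (1ℚ + fromℕ (length xs)) * c   ≡⟨ cong (_* c) (sym (fromℕ-+ 1 (length xs))) ⟩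
  fromℕ (suc (length xs)) * c    ∎
  where open ≡-Reasoning

length-filter : ∀ {A : Set} {p} {P : Pred A p} (P? : Decidable P) (xs : List A) →
  fromℕ (length (filter P? xs)) ≡ Σ xs (λ x → ind (does (P? x)))
length-filter P? [] = refl
length-filter P? (x ∷ xs) with does (P? x)
... | true = trans (fromℕ-+ 1 (length (filter P? xs))) (cong (1ℚ +_) (length-filter P? xs))
... | false = trans (length-filter P? xs) (sym (QP.+-identityˡ (Σ xs (λ x → ind (does (P? x))))))

sumℕ-cast : ∀ {A : Set} (xs : List A) (f : A → ℕ) → fromℕ (sumℕ (map f xs)) ≡ Σ xs (fromℕ ∘ f)
sumℕ-cast [] f = refl
sumℕ-cast (x ∷ xs) f = trans (fromℕ-+ (f x) _) (cong (fromℕ (f x) +_) (sumℕ-cast xs f))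

sum-nonneg : ∀ {A : Set} {xs : List A} {f} → All (λ x → 0ℚ Q.≤ f x) xs → 0ℚ Q.≤ Σ xs f
sum-nonneg {xs = xs} {f} h = subst (λ z → z Q.≤ Σ xs f) (sum-0 xs) (sum-mono h)

ΣV : ∀ n → (Fin n → ℚ) → ℚ
ΣV n f = Σ (allFin n) f

ΣV-suc : ∀ n (f : Fin (suc n) → ℚ) → ΣV (suc n) f ≡ f zero + ΣV n (f ∘ suc)
ΣV-suc n f = cong (f zero +_) (cong sumℚ (trans (LP.map-tabulate suc f) (sym (LP.map-tabulate id (f ∘ suc)))))

≡ᵇ-refl : ∀ a → (a ≡ᵇ a) ≡ true
≡ᵇ-refl zero = refl
≡ᵇ-refl (suc a) = ≡ᵇ-refl a

≢⇒≡ᵇ≡false : ∀ {a b} → ¬ a ≡ b → (a ≡ᵇ b) ≡ false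
≢⇒≡ᵇ≡false {zero} {zero} ne = ⊥-elim (ne refl)
≢⇒≡ᵇ≡false {zero} {suc b} ne = refl
≢⇒≡ᵇ≡false {suc a} {zero} ne = refl
≢⇒≡ᵇ≡false {suc a} {suc b} ne = ≢⇒≡ᵇ≡false {a} {b} (λ e → ne (cong suc e))

frac-pos : ∀ a b → 0ℚ Q.< frac (suc a) (suc b)
frac-pos a b = QP.toℚᵘ-cancel-< (UP.<-respʳ-≃ (UP.≃-sym (toℚᵘ-frac (suc a) b))
  (*<* (ℤ.+<+ (ℕ.s≤s ℕ.z≤n))))

frac-nonneg : ∀ a b → 0ℚ Q.≤ frac a b
frac-nonneg a zero = QP.≤-refl
frac-nonneg a (suc b) = QP.toℚᵘ-cancel-≤ (UP.≤-respʳ-≃ (UP.≃-sym (toℚᵘ-frac a b))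
  (*≤* (subst (λ z → ℤ.+ 0 ℤ.≤ z) (sym (ℤP.*-identityʳ (ℤ.+ a))) (ℤ.+≤+ ℕ.z≤n))))

^ℚ-nonneg : ∀ {x} a → 0ℚ Q.≤ x → 0ℚ Q.≤ x ^ℚ a
^ℚ-nonneg zero h = QP.<⇒≤ (fromℕ-suc-pos 0)
^ℚ-nonneg (suc a) h = *-nonneg h (^ℚ-nonneg a h)

^ℚ-pos : ∀ {x} a → 0ℚ Q.< x → 0ℚ Q.< x ^ℚ a
^ℚ-pos zero h = fromℕ-suc-pos 0
^ℚ-pos (suc a) h = *-pos h (^ℚ-pos a h)

^ℚ≤1 : ∀ {x} a → 0ℚ Q.≤ x → x Q.≤ 1ℚ → x ^ℚ a Q.≤ 1ℚ
^ℚ≤1 zero h h1 = QP.≤-refl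
^ℚ≤1 {x} (suc a) h h1 = QP.≤-trans (*-monoʳ-≤-0≤ h (^ℚ≤1 a h h1))
  (QP.≤-trans (QP.≤-reflexive (solve 1 (λ x → x :* con 1ℚ := x) refl x)) h1)

^ℚ-+ : ∀ x a c → x ^ℚ (a ℕ.+ c) ≡ x ^ℚ a * x ^ℚ c
^ℚ-+ x zero c = sym (QP.*-identityˡ _)
^ℚ-+ x (suc a) c rewrite ^ℚ-+ x a c = sym (QP.*-assoc x (x ^ℚ a) (x ^ℚ c))

^ℚ-+-≤ : ∀ {x} a c → 0ℚ Q.≤ x → x Q.≤ 1ℚ → x ^ℚ (a ℕ.+ c) Q.≤ x ^ℚ a
^ℚ-+-≤ {x} a c h h1 = QP.≤-trans (QP.≤-reflexive (^ℚ-+ x a c))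
  (QP.≤-trans (*-monoʳ-≤-0≤ (^ℚ-nonneg a h) (^ℚ≤1 c h h1)) (QP.≤-reflexive (QP.*-identityʳ _)))

bernoulli-inequality : ∀ {x} b → 0ℚ Q.≤ x → x Q.≤ 1ℚ → 1ℚ - fromℕ b * x Q.≤ (1ℚ - x) ^ℚ b
bernoulli-inequality {x} zero h h1 = QP.≤-reflexive (solve 1 (λ x → con 1ℚ :- con 0ℚ :* x := con 1ℚ) refl x)
bernoulli-inequality {x} (suc b) h h1 = QP.≤-trans stp (*-monoʳ-≤-0≤ y≥0 (bernoulli-inequality b h h1))
  where
  y≥0 : 0ℚ Q.≤ 1ℚ - x
  y≥0 = p≤q⇒0≤q-p h1
  stp : 1ℚ - fromℕ (suc b) * x Q.≤ (1ℚ - x) * (1ℚ - fromℕ b * x)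
  stp = 0≤q-p⇒p≤q (subst (0ℚ Q.≤_) (trans (solve 2 (λ x B → B :* (x :* x) := (con 1ℚ :- x) :* (con 1ℚ :- B :* x) :- (con 1ℚ :- (con 1ℚ :+ B) :* x)) refl x (fromℕ b))
            (cong (λ z → (1ℚ - x) * (1ℚ - fromℕ b * x) - (1ℚ - z * x)) (sym (fromℕ-+ 1 b))))
            (*-nonneg (fromℕ-nonneg b) (*-nonneg h h)))

Term : Set
Term = ℕ × ℕ × ℚ

xExp yExp : Term → ℕ
xExp (a , b , v) = a
yExp (a , b , v) = b
coeff : Term → ℚ
coeff (a , b , v) = v

evalTerm : ℚ → Term → ℚ
evalTerm x (a , b , v) = (x ^ℚ a * (1ℚ - x) ^ℚ b) * v

coeffAt : ℕ → Term → ℚ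
coeffAt j (a , b , v) = if a ≡ᵇ j then v else 0ℚ

-- Each term is at least x ^ j (coeffAt j t - x · slope), so the whole sum is
-- x ^ j (Σ coeffAt j - O(x)).
module _ (j m Mn : ℕ) (x : ℚ) (x>0 : 0ℚ Q.< x) (x≤1 : x Q.≤ 1ℚ) where
  M slope : ℚ
  M = fromℕ Mn
  slope = fromℕ (suc m ℕ.* Mn)
  x≥0 : 0ℚ Q.≤ x
  x≥0 = QP.<⇒≤ x>0

  evalTerm-lower-bound : ∀ t → yExp t ℕ.≤ m → (xExp t ℕ.< j → coeff t ≡ 0ℚ) → (- M Q.≤ coeff t × coeff t Q.≤ M) →
    x ^ℚ j * (coeffAt j t - x * slope) Q.≤ evalTerm x t
  evalTerm-lower-bound (a , b , v) b≤m z (v≥ , v≤) with ℕP.<-cmp a j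
  ... | tri< a<j _ _ rewrite z a<j | ≢⇒≡ᵇ≡false {a} {j} (ℕP.<⇒≢ a<j) =
    0≤q-p⇒p≤q (subst (0ℚ Q.≤_) (solve 5 (λ P Y X x slope → X :* (x :* slope) := (P :* Y) :* con 0ℚ :- X :* (con 0ℚ :- x :* slope)) refl (x ^ℚ a) ((1ℚ - x) ^ℚ b) (x ^ℚ j) x slope)
      (*-nonneg (^ℚ-nonneg j x≥0) (*-nonneg x≥0 (fromℕ-nonneg (suc m ℕ.* Mn)))))
  ... | tri≈ _ refl _ rewrite ≡ᵇ-refl a = 0≤q-p⇒p≤q (subst (0ℚ Q.≤_)
      (solve 5 (λ X Y v x slope → X :* (x :* slope :- (con 1ℚ :- Y) :* v) := (X :* Y) :* v :- X :* (v :- x :* slope)) refl (x ^ℚ a) Y v x slope)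
      (*-nonneg (^ℚ-nonneg a x≥0) (p≤q⇒0≤q-p chain)))
    where
    Y = (1ℚ - x) ^ℚ b
    u≥0 : 0ℚ Q.≤ 1ℚ - Y
    u≥0 = p≤q⇒0≤q-p (^ℚ≤1 b (p≤q⇒0≤q-p x≤1) (0≤q-p⇒p≤q (subst (0ℚ Q.≤_) (solve 1 (λ x → x := con 1ℚ :- (con 1ℚ :- x)) refl x) x≥0)))
    u≤ : 1ℚ - Y Q.≤ fromℕ b * x
    u≤ = 0≤q-p⇒p≤q (subst (0ℚ Q.≤_) (solve 2 (λ Y bx → Y :- (con 1ℚ :- bx) := bx :- (con 1ℚ :- Y)) refl Y (fromℕ b * x)) (p≤q⇒0≤q-p (bernoulli-inequality b x≥0 x≤1)))
    chain : (1ℚ - Y) * v Q.≤ x * slope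
    chain = begin
      (1ℚ - Y) * v ≤⟨ *-monoʳ-≤-0≤ u≥0 v≤ ⟩
      (1ℚ - Y) * M ≡⟨ QP.*-comm _ M ⟩
      M * (1ℚ - Y) ≤⟨ *-monoʳ-≤-0≤ (fromℕ-nonneg Mn) u≤ ⟩
      M * (fromℕ b * x) ≤⟨ *-monoʳ-≤-0≤ (fromℕ-nonneg Mn) (QP.*-monoʳ-≤-nonNeg x {{Q.nonNegative x≥0}} (fromℕ-mono-≤ (ℕP.m≤n⇒m≤1+n b≤m))) ⟩
      M * (fromℕ (suc m) * x) ≡⟨ solve 3 (λ M s x → M :* (s :* x) := x :* (s :* M)) refl M (fromℕ (suc m)) x ⟩
      x * (fromℕ (suc m) * M) ≡⟨ cong (x *_) (sym (fromℕ-* (suc m) Mn)) ⟩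
      x * slope ∎
      where open QP.≤-Reasoning
  ... | tri> _ _ j<a rewrite ≢⇒≡ᵇ≡false {a} {j} (λ e → ℕP.<⇒≢ j<a (sym e)) = 0≤q-p⇒p≤q (subst (0ℚ Q.≤_)
      (solve 7 (λ P Y v X x slope M' → (P :* Y) :* (v :+ M') :+ (X :* x :* slope :- (P :* Y) :* M') := (P :* Y) :* v :- X :* (con 0ℚ :- x :* slope)) refl P Y v X x slope M)
      (+-nonneg (*-nonneg PY≥0 (subst (0ℚ Q.≤_) (solve 2 (λ v M → v :- (:- M) := v :+ M) refl v M) (p≤q⇒0≤q-p v≥))) (p≤q⇒0≤q-p chain)))
    where
    P = x ^ℚ a
    Y = (1ℚ - x) ^ℚ b
    X = x ^ℚ j
    PY≥0 : 0ℚ Q.≤ P * Y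
    PY≥0 = *-nonneg (^ℚ-nonneg a x≥0) (^ℚ-nonneg b (p≤q⇒0≤q-p x≤1))
    a≡ : a ≡ suc j ℕ.+ (a ℕ.∸ suc j)
    a≡ = sym (ℕP.m+[n∸m]≡n j<a)
    P≤ : P Q.≤ X * x
    P≤ = begin
      P ≡⟨ cong (x ^ℚ_) a≡ ⟩
      x ^ℚ (suc j ℕ.+ (a ℕ.∸ suc j)) ≤⟨ ^ℚ-+-≤ (suc j) (a ℕ.∸ suc j) x≥0 x≤1 ⟩
      x * X ≡⟨ QP.*-comm x X ⟩
      X * x ∎
      where open QP.≤-Reasoning
    Y≤1 : Y Q.≤ 1ℚ
    Y≤1 = ^ℚ≤1 b (p≤q⇒0≤q-p x≤1) (0≤q-p⇒p≤q (subst (0ℚ Q.≤_) (solve 1 (λ x → x := con 1ℚ :- (con 1ℚ :- x)) refl x) x≥0))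
    M≤c : M Q.≤ slope
    M≤c = fromℕ-mono-≤ (ℕP.m≤n*m Mn (suc m))
    chain : (P * Y) * M Q.≤ X * x * slope
    chain = begin
      (P * Y) * M ≤⟨ QP.*-monoʳ-≤-nonNeg M {{Q.nonNegative (fromℕ-nonneg Mn)}} (QP.≤-trans (*-monoʳ-≤-0≤ (^ℚ-nonneg a x≥0) Y≤1) (QP.≤-reflexive (QP.*-identityʳ P))) ⟩
      P * M ≤⟨ QP.*-monoʳ-≤-nonNeg M {{Q.nonNegative (fromℕ-nonneg Mn)}} P≤ ⟩
      (X * x) * M ≤⟨ *-monoʳ-≤-0≤ (*-nonneg (^ℚ-nonneg j x≥0) x≥0) M≤c ⟩
      X * x * slope ∎
      where open QP.≤-Reasoning

evalTerms-lower-bound : ∀ (j m Mn : ℕ) (x : ℚ) (x>0 : 0ℚ Q.< x) (x≤1 : x Q.≤ 1ℚ) (ts : List Term) →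
  All (λ t → yExp t ℕ.≤ m) ts → All (λ t → xExp t ℕ.< j → coeff t ≡ 0ℚ) ts →
  All (λ t → - fromℕ Mn Q.≤ coeff t × coeff t Q.≤ fromℕ Mn) ts →
  All (λ t → x ^ℚ j * (coeffAt j t - x * fromℕ (suc m ℕ.* Mn)) Q.≤ evalTerm x t) ts
evalTerms-lower-bound j m Mn x x>0 x≤1 [] [] [] [] = []
evalTerms-lower-bound j m Mn x x>0 x≤1 (t ∷ ts) (h1 ∷ H1) (h2 ∷ H2) (h3 ∷ H3) =
  evalTerm-lower-bound j m Mn x x>0 x≤1 t h1 h2 h3 ∷ evalTerms-lower-bound j m Mn x x>0 x≤1 ts H1 H2 H3

positive-near-0 : ∀ (ts : List Term) (j m Mn : ℕ) →
  All (λ t → yExp t ℕ.≤ m) ts → All (λ t → xExp t ℕ.< j → coeff t ≡ 0ℚ) ts →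
  All (λ t → - fromℕ Mn Q.≤ coeff t × coeff t Q.≤ fromℕ Mn) ts →
  0ℚ Q.< Σ ts (coeffAt j) →
  ∃ λ ε → 0ℚ Q.< ε × (∀ x → 0ℚ Q.< x → x Q.< ε → x Q.≤ 1ℚ → 0ℚ Q.< Σ ts (evalTerm x))
positive-near-0 ts j m Mn H1 H2 H3 B>0 = ε , *-pos B>0 (frac-pos 0 N) , main
  where
  cn N : ℕ
  cn = suc m ℕ.* Mn
  N = length ts ℕ.* cn
  B ε : ℚ
  B = Σ ts (coeffAt j)
  ε = B * frac 1 (suc N)
  main : ∀ x → 0ℚ Q.< x → x Q.< ε → x Q.≤ 1ℚ → 0ℚ Q.< Σ ts (evalTerm x)
  main x x>0 x<ε x≤1 = QP.<-≤-trans pos (sum-mono (evalTerms-lower-bound j m Mn x x>0 x≤1 ts H1 H2 H3))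
    where
    cq = fromℕ cn
    X = x ^ℚ j
    eqS : Σ ts (λ t → X * (coeffAt j t - x * cq)) ≡ X * (B - fromℕ (length ts) * (x * cq))
    eqS = trans (sum-*ˡ ts X (λ t → coeffAt j t - x * cq)) (cong (X *_) (trans (sum-- ts (coeffAt j) (λ _ → x * cq)) (cong (λ z → B - z) (sum-const ts (x * cq)))))
    lt1 : x * fromℕ (suc N) Q.< B
    lt1 = begin-strict
      x * fromℕ (suc N) <⟨ QP.*-monoˡ-<-pos (fromℕ (suc N)) {{Q.positive (fromℕ-suc-pos N)}} x<ε ⟩
      ε * fromℕ (suc N) ≡⟨ QP.*-assoc B _ _ ⟩
      B * (frac 1 (suc N) * fromℕ (suc N)) ≡⟨ cong (B *_) (frac*den≡num 1 N) ⟩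
      B * 1ℚ ≡⟨ QP.*-identityʳ B ⟩
      B ∎
      where open QP.≤-Reasoning
    le2 : fromℕ (length ts) * (x * cq) Q.≤ x * fromℕ (suc N)
    le2 = begin
      fromℕ (length ts) * (x * cq) ≡⟨ solve 3 (λ l x c → l :* (x :* c) := x :* (l :* c)) refl (fromℕ (length ts)) x cq ⟩
      x * (fromℕ (length ts) * cq) ≡⟨ cong (x *_) (sym (fromℕ-* (length ts) cn)) ⟩
      x * fromℕ N ≤⟨ *-monoʳ-≤-0≤ (QP.<⇒≤ x>0) (fromℕ-mono-≤ (ℕP.n≤1+n N)) ⟩
      x * fromℕ (suc N) ∎
      where open QP.≤-Reasoning
    pos : 0ℚ Q.< Σ ts (λ t → X * (coeffAt j t - x * cq))
    pos = subst (0ℚ Q.<_) (sym eqS) (*-pos (^ℚ-pos j x>0) (p<q⇒0<q-p (QP.≤-<-trans le2 lt1)))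

-- Part (b) expands in powers of 1 - β, i.e. in the number of lost edges.
mirror : Term → Term
mirror (a , b , v) = (b , a , - v)

evalTerm-mirror : ∀ β t → evalTerm (1ℚ - β) (mirror t) ≡ - evalTerm β t
evalTerm-mirror β (a , b , v) = trans (cong (λ y → ((1ℚ - β) ^ℚ b * y ^ℚ a) * - v) (solve 1 (λ β → con 1ℚ :- (con 1ℚ :- β) := β) refl β))
  (solve 3 (λ P Q v → (Q :* P) :* (:- v) := :- ((P :* Q) :* v)) refl (β ^ℚ a) ((1ℚ - β) ^ℚ b) v)

1-β-in-range : ∀ {ε β} → 0ℚ Q.≤ β → 1ℚ - ε Q.< β → β Q.< 1ℚ → 0ℚ Q.< 1ℚ - β × 1ℚ - β Q.< ε × 1ℚ - β Q.≤ 1ℚ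
1-β-in-range {ε} {β} 0≤β 1-ε<β β<1 =
  p<q⇒0<q-p β<1 ,
  0<q-p⇒p<q (subst (0ℚ Q.<_) (solve 3 (λ o e b → b :- (o :- e) := e :- (o :- b)) refl 1ℚ ε β) (p<q⇒0<q-p 1-ε<β)) ,
  0≤q-p⇒p≤q (subst (0ℚ Q.≤_) (solve 2 (λ o b → b := o :- (o :- b)) refl 1ℚ β) 0≤β)

module _ {n : ℕ} where
  keepEdge : Edge n → Config n → Config n
  keepEdge e c = cfg (e ∷ Config.kept c) (suc (Config.nKept c)) (Config.nLost c)
  loseEdge : Config n → Config n
  loseEdge c = cfg (Config.kept c) (Config.nKept c) (suc (Config.nLost c))

  sum-configs-∷ : ∀ (e : Edge n) es (f : Config n → ℚ) →
    Σ (configs (e ∷ es)) f ≡ Σ (configs es) (λ c → f (keepEdge e c) + f (loseEdge c))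
  sum-configs-∷ e es f = trans (sum-concatMap (configs es) _ f)
    (sum-cong (configs es) (λ c → cong (f (keepEdge e c) +_) (QP.+-identityʳ (f (loseEdge c)))))

  All-concatMap : ∀ {ℓ} {A B : Set} {P : B → Set ℓ} (g : A → List B) (xs : List A) → All (λ x → All P (g x)) xs → All P (concatMap g xs)
  All-concatMap g [] [] = []
  All-concatMap g (x ∷ xs) (h ∷ hs) = ++⁺ h (All-concatMap g xs hs)

  All-configs-∷ : ∀ {ℓ} {P : Config n → Set ℓ} (e : Edge n) es → All (λ c → P (keepEdge e c) × P (loseEdge c)) (configs es) → All P (configs (e ∷ es))
  All-configs-∷ e es h = All-concatMap _ (configs es) (All.map (λ { (p , q) → p ∷ q ∷ [] }) h)

  ConfigOf : List (Edge n) → Config n → Set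
  ConfigOf es c = (Config.nKept c ℕ.+ Config.nLost c ≡ length es) × (length (Config.kept c) ≡ Config.nKept c) × (∀ x → x ∈ Config.kept c → x ∈ es)

  configs-ConfigOf : ∀ es → All (ConfigOf es) (configs es)
  configs-ConfigOf [] = (refl , refl , (λ x ())) ∷ []
  configs-ConfigOf (e ∷ es) = All-configs-∷ e es (All.map (λ { {c} (v1 , v2 , v3) →
    (cong suc v1 , cong suc v2 , (λ { x (here p) → here p ; x (there p) → there (v3 x p) })) ,
    (trans (ℕP.+-suc _ _) (cong suc v1) , v2 , (λ x p → there (v3 x p))) }) (configs-ConfigOf es))

  LostBound : List (Edge n) → Config n → Set₁
  LostBound es c = ∀ (P : Pred (Edge n) _) (P? : Decidable P) → (∀ e → e ∈ es → P e → ¬ e ∈ Config.kept c) → length (filter P? es) ℕ.≤ Config.nLost c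

  configs-LostBound : ∀ es → All (LostBound es) (configs es)
  configs-LostBound [] = (λ P P? h → ℕ.z≤n) ∷ []
  configs-LostBound (e ∷ es) = All-configs-∷ e es (All.map (λ { {c} h → kp c h , lp c h }) (configs-LostBound es))
    where
    kp : ∀ c → LostBound es c → LostBound (e ∷ es) (keepEdge e c)
    kp c h P P? hh with P? e
    ... | yes pe = ⊥-elim (hh e (here refl) pe (here refl))
    ... | no _ = h P P? (λ x xin px xk → hh x (there xin) px (there xk))
    lp : ∀ c → LostBound es c → LostBound (e ∷ es) (loseEdge c)
    lp c h P P? hh with P? e
    ... | yes pe = ℕ.s≤s (h P P? (λ x xin px xk → hh x (there xin) px xk))
    ... | no _ = ℕP.m≤n⇒m≤1+n (h P P? (λ x xin px xk → hh x (there xin) px xk))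

  sum-nKept≡0 : ∀ es (f : List (Edge n) → ℚ) →
    Σ (configs es) (λ c → if Config.nKept c ≡ᵇ 0 then f (Config.kept c) else 0ℚ) ≡ f []
  sum-nKept≡0 [] f = QP.+-identityʳ (f [])
  sum-nKept≡0 (e ∷ es) f = trans (sum-configs-∷ e es _) (trans (sum-cong (configs es) (λ c → QP.+-identityˡ _)) (sum-nKept≡0 es f))

  sum-nKept≡1 : ∀ es (f : List (Edge n) → ℚ) →
    Σ (configs es) (λ c → if Config.nKept c ≡ᵇ 1 then f (Config.kept c) else 0ℚ) ≡ Σ es (λ e → f (e ∷ []))
  sum-nKept≡1 [] f = refl
  sum-nKept≡1 (e ∷ es) f = trans (sum-configs-∷ e es _)
    (trans (sum-+ (configs es) (λ c → if Config.nKept c ≡ᵇ 0 then f (e ∷ Config.kept c) else 0ℚ) _)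
      (cong₂ _+_ (sum-nKept≡0 es (λ K → f (e ∷ K))) (sum-nKept≡1 es f)))

  avoids : (Edge n → Bool) → List (Edge n) → Bool
  avoids p K = not (any p K)

  sum-nLost≡-avoiding : ∀ (p : Edge n → Bool) es d → d ℕ.≤ length (filter (B.T? ∘ p) es) →
    Σ (configs es) (λ c → if Config.nLost c ≡ᵇ d then ind (avoids p (Config.kept c)) else 0ℚ)
      ≡ (if d ≡ᵇ length (filter (B.T? ∘ p) es) then 1ℚ else 0ℚ)
  sum-nLost≡-avoiding p [] zero h = refl
  sum-nLost≡-avoiding p (e ∷ es) d h with p e in pe
  ... | true = trans (sum-configs-∷ e es _) (trans (sum-cong (configs es) (λ c → trans (cong (_+ _) (kz c)) (QP.+-identityˡ _))) (lem d h))
    where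
    kz : ∀ c → (if Config.nLost c ≡ᵇ d then ind (avoids p (e ∷ Config.kept c)) else 0ℚ) ≡ 0ℚ
    kz c rewrite pe with Config.nLost c ≡ᵇ d
    ... | true = refl
    ... | false = refl
    lem : ∀ d → d ℕ.≤ suc (length (filter (B.T? ∘ p) es)) →
      Σ (configs es) (λ c → if suc (Config.nLost c) ≡ᵇ d then ind (avoids p (Config.kept c)) else 0ℚ)
      ≡ (if d ≡ᵇ suc (length (filter (B.T? ∘ p) es)) then 1ℚ else 0ℚ)
    lem zero h = sum-0 (configs es)
    lem (suc d) h = sum-nLost≡-avoiding p es d (ℕP.≤-pred h)
  ... | false = trans (sum-configs-∷ e es _) (trans (sum-+ (configs es) _ _) (trans (cong₂ _+_ (trans (sum-cong (configs es) kk) (sum-nLost≡-avoiding p es d h)) (lem d h)) (QP.+-identityʳ _)))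
    where
    kk : ∀ c → (if Config.nLost c ≡ᵇ d then ind (avoids p (e ∷ Config.kept c)) else 0ℚ) ≡ (if Config.nLost c ≡ᵇ d then ind (avoids p (Config.kept c)) else 0ℚ)
    kk c rewrite pe = refl
    lem : ∀ d → d ℕ.≤ length (filter (B.T? ∘ p) es) →
      Σ (configs es) (λ c → if suc (Config.nLost c) ≡ᵇ d then ind (avoids p (Config.kept c)) else 0ℚ) ≡ 0ℚ
    lem zero h = sum-0 (configs es)
    lem (suc d) h = trans (sum-nLost≡-avoiding p es d (ℕP.≤-trans (ℕP.n≤1+n d) h))
      (cong (λ b → if b then 1ℚ else 0ℚ) (≢⇒≡ᵇ≡false {d} (ℕP.<⇒≢ h)))

guardedInd : Bool → Bool → Bool → ℚ
guardedInd b1 b2 b3 = if b1 ∧ b2 then ind b3 else 0ℚ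

guardedInd-false : ∀ b1 b2 → guardedInd b1 b2 false ≡ 0ℚ
guardedInd-false true true = refl
guardedInd-false true false = refl
guardedInd-false false b2 = refl

guardedInd-⊈ : ∀ b1 b3 → guardedInd b1 false b3 ≡ 0ℚ
guardedInd-⊈ true b3 = refl
guardedInd-⊈ false b3 = refl

#supersets : ∀ n → ℕ → Subset n → Subset n → ℚ
#supersets n k X A = Σ (allSubsets n) (λ S → guardedInd (does (∣ S ∣ ℕP.≟ k)) (does (S ⊆? X)) (does (A ⊆? S)))

sum-allSubsets-suc : ∀ n (f : Subset (suc n) → ℚ) → Σ (allSubsets (suc n)) f ≡ Σ (allSubsets n) (λ s → f (true ∷ s) + f (false ∷ s))
sum-allSubsets-suc n f = trans (sum-concatMap (allSubsets n) _ f)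
    (sum-cong (allSubsets n) (λ s → cong (f (true ∷ s) +_) (QP.+-identityʳ (f (false ∷ s)))))

+-≡0ʳ : ∀ {a b} → b ≡ 0ℚ → a + b ≡ a
+-≡0ʳ {a} refl = QP.+-identityʳ a
+-≡0ˡ : ∀ {a b} → a ≡ 0ℚ → a + b ≡ b
+-≡0ˡ {b = b} refl = QP.+-identityˡ b
+-≡0 : ∀ {a b} → a ≡ 0ℚ → b ≡ 0ℚ → a + b ≡ 0ℚ
+-≡0 refl refl = refl

module #supersets-∷ {n : ℕ} (X A : Subset n) where
  private
    hasSize : ∀ k (s : Subset (suc n)) → Bool
    hasSize k s = does (∣ s ∣ ℕP.≟ k)

  in-in-suc : ∀ k → #supersets (suc n) (suc k) (true ∷ X) (true ∷ A) ≡ #supersets n k X A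
  in-in-suc k = trans (sum-allSubsets-suc n _) (sum-cong (allSubsets n) (λ s → +-≡0ʳ (guardedInd-false (hasSize (suc k) (false ∷ s)) (does (s ⊆? X)))))
  in-in-zero : #supersets (suc n) 0 (true ∷ X) (true ∷ A) ≡ 0ℚ
  in-in-zero = trans (sum-allSubsets-suc n _) (trans (sum-cong (allSubsets n) (λ s → +-≡0ʳ (guardedInd-false (hasSize 0 (false ∷ s)) (does (s ⊆? X))))) (sum-0 (allSubsets n)))
  in-out-suc : ∀ k → #supersets (suc n) (suc k) (true ∷ X) (false ∷ A) ≡ #supersets n k X A + #supersets n (suc k) X A
  in-out-suc k = trans (sum-allSubsets-suc n _) (sum-+ (allSubsets n) _ _)
  in-out-zero : #supersets (suc n) 0 (true ∷ X) (false ∷ A) ≡ #supersets n 0 X A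
  in-out-zero = trans (sum-allSubsets-suc n _) (sum-cong (allSubsets n) (λ s → QP.+-identityˡ _))
  out-in : ∀ k → #supersets (suc n) k (false ∷ X) (true ∷ A) ≡ 0ℚ
  out-in k = trans (sum-allSubsets-suc n _) (trans (sum-cong (allSubsets n) (λ s → +-≡0 (guardedInd-⊈ (hasSize k (true ∷ s)) (does (A ⊆? s))) (guardedInd-false (hasSize k (false ∷ s)) (does (s ⊆? X))))) (sum-0 (allSubsets n)))
  out-out : ∀ k → #supersets (suc n) k (false ∷ X) (false ∷ A) ≡ #supersets n k X A
  out-out k = trans (sum-allSubsets-suc n _) (sum-cong (allSubsets n) (λ s → +-≡0ˡ (guardedInd-⊈ (hasSize k (true ∷ s)) (does (A ⊆? s)))))

⊆⇒∣∣≤ : ∀ {n} (X A : Subset n) → does (A ⊆? X) ≡ true → ∣ A ∣ ℕ.≤ ∣ X ∣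
⊆⇒∣∣≤ [] [] h = ℕ.z≤n
⊆⇒∣∣≤ (true ∷ X) (true ∷ A) h = ℕ.s≤s (⊆⇒∣∣≤ X A h)
⊆⇒∣∣≤ (true ∷ X) (false ∷ A) h = ℕP.m≤n⇒m≤1+n (⊆⇒∣∣≤ X A h)
⊆⇒∣∣≤ (false ∷ X) (true ∷ A) ()
⊆⇒∣∣≤ (false ∷ X) (false ∷ A) h = ⊆⇒∣∣≤ X A h

#supersets-⊈ : ∀ {n} (X A : Subset n) k → does (A ⊆? X) ≡ false → #supersets n k X A ≡ 0ℚ
#supersets-⊈ [] [] k ()
#supersets-⊈ (true ∷ X) (true ∷ A) zero h = #supersets-∷.in-in-zero X A
#supersets-⊈ (true ∷ X) (true ∷ A) (suc k) h = trans (#supersets-∷.in-in-suc X A k) (#supersets-⊈ X A k h)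
#supersets-⊈ (true ∷ X) (false ∷ A) zero h = trans (#supersets-∷.in-out-zero X A) (#supersets-⊈ X A 0 h)
#supersets-⊈ (true ∷ X) (false ∷ A) (suc k) h = trans (#supersets-∷.in-out-suc X A k) (+-≡0 (#supersets-⊈ X A k h) (#supersets-⊈ X A (suc k) h))
#supersets-⊈ (false ∷ X) (true ∷ A) k h = #supersets-∷.out-in X A k
#supersets-⊈ (false ∷ X) (false ∷ A) k h = trans (#supersets-∷.out-out X A k) (#supersets-⊈ X A k h)

#supersets-small : ∀ {n} (X A : Subset n) k → k ℕ.< ∣ A ∣ → #supersets n k X A ≡ 0ℚ
#supersets-small [] [] k ()
#supersets-small (true ∷ X) (true ∷ A) zero h = #supersets-∷.in-in-zero X A
#supersets-small (true ∷ X) (true ∷ A) (suc k) h = trans (#supersets-∷.in-in-suc X A k) (#supersets-small X A k (ℕP.≤-pred h))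
#supersets-small (true ∷ X) (false ∷ A) zero h = trans (#supersets-∷.in-out-zero X A) (#supersets-small X A 0 h)
#supersets-small (true ∷ X) (false ∷ A) (suc k) h = trans (#supersets-∷.in-out-suc X A k) (+-≡0 (#supersets-small X A k (ℕP.<-trans (ℕP.n<1+n k) h)) (#supersets-small X A (suc k) h))
#supersets-small (false ∷ X) (true ∷ A) k h = #supersets-∷.out-in X A k
#supersets-small (false ∷ X) (false ∷ A) k h = trans (#supersets-∷.out-out X A k) (#supersets-small X A k h)

#supersets≡binom : ∀ {n} (X A : Subset n) a x j k → does (A ⊆? X) ≡ true → ∣ A ∣ ≡ a → ∣ X ∣ ≡ a ℕ.+ x → k ≡ a ℕ.+ j →
  #supersets n k X A ≡ fromℕ (binom x j)
#supersets≡binom [] [] .0 .0 zero .0 h refl refl refl = refl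
#supersets≡binom [] [] .0 .0 (suc j) .(suc j) h refl refl refl = refl
#supersets≡binom (true ∷ X) (true ∷ A) .(suc (∣ A ∣)) x j .(suc (∣ A ∣ ℕ.+ j)) h refl hx refl =
  trans (#supersets-∷.in-in-suc X A (∣ A ∣ ℕ.+ j)) (#supersets≡binom X A (∣ A ∣) x j _ h refl (ℕP.suc-injective hx) refl)
#supersets≡binom (true ∷ X) (false ∷ A) .(∣ A ∣) zero j k h refl hx hk =
  ⊥-elim (ℕP.<-irrefl refl (ℕP.≤-trans (ℕP.≤-reflexive (trans hx (ℕP.+-identityʳ _))) (⊆⇒∣∣≤ X A h)))
#supersets≡binom (true ∷ X) (false ∷ A) .(∣ A ∣) (suc x) zero zero h refl hx hk =
  trans (#supersets-∷.in-out-zero X A) (#supersets≡binom X A (∣ A ∣) x 0 0 h refl hx' hk)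
  where hx' = ℕP.suc-injective (trans hx (ℕP.+-suc _ x))
#supersets≡binom (true ∷ X) (false ∷ A) .(∣ A ∣) (suc x) (suc j) zero h refl hx hk =
  ⊥-elim (ℕP.0≢1+n (trans hk (ℕP.+-suc _ j)))
#supersets≡binom (true ∷ X) (false ∷ A) .(∣ A ∣) (suc x) zero (suc k) h refl hx hk =
  trans (trans (#supersets-∷.in-out-suc X A k) (+-≡0ˡ (#supersets-small X A k (ℕP.≤-reflexive (trans hk (ℕP.+-identityʳ _))))))
    (#supersets≡binom X A (∣ A ∣) x 0 (suc k) h refl hx' hk)
  where hx' = ℕP.suc-injective (trans hx (ℕP.+-suc _ x))
#supersets≡binom (true ∷ X) (false ∷ A) .(∣ A ∣) (suc x) (suc j) (suc k) h refl hx hk =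
  trans (#supersets-∷.in-out-suc X A k) (trans (cong₂ _+_ (#supersets≡binom X A (∣ A ∣) x j k h refl hx' hk') (#supersets≡binom X A (∣ A ∣) x (suc j) (suc k) h refl hx' hk))
    (sym (fromℕ-+ (binom x j) (binom x (suc j)))))
  where hx' = ℕP.suc-injective (trans hx (ℕP.+-suc _ x))
        hk' = ℕP.suc-injective (trans hk (ℕP.+-suc _ j))
#supersets≡binom (false ∷ X) (true ∷ A) a x j k () ha hx hk
#supersets≡binom (false ∷ X) (false ∷ A) a x j k h ha hx hk = trans (#supersets-∷.out-out X A k) (#supersets≡binom X A a x j k h ha hx hk)

⊆?-∷ : ∀ {n} a s (A S : Subset n) → does ((a ∷ A) ⊆? (s ∷ S)) ≡ (not a ∨ s) ∧ does (A ⊆? S)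
⊆?-∷ true true A S = refl
⊆?-∷ true false A S = refl
⊆?-∷ false true A S = refl
⊆?-∷ false false A S = refl

⊥⊆? : ∀ {n} (S : Subset n) → does (⊥ ⊆? S) ≡ true
⊥⊆? [] = refl
⊥⊆? (s ∷ S) = trans (⊆?-∷ false s ⊥ S) (⊥⊆? S)

⁅⁆⊆? : ∀ {n} (w : Fin n) (S : Subset n) → does (⁅ w ⁆ ⊆? S) ≡ lookup S w
⁅⁆⊆? zero (s ∷ S) = trans (⊆?-∷ true s ⊥ S) (trans (cong (s ∧_) (⊥⊆? S)) (BP.∧-identityʳ s))
⁅⁆⊆? (suc w) (s ∷ S) = trans (⊆?-∷ false s ⁅ w ⁆ S) (⁅⁆⊆? w S)

⁅⁆∪⁅⁆⊆? : ∀ {n} (i j : Fin n) (S : Subset n) → ¬ i ≡ j → does ((⁅ i ⁆ ∪ ⁅ j ⁆) ⊆? S) ≡ lookup S i ∧ lookup S j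
⁅⁆∪⁅⁆⊆? zero zero S ne = ⊥-elim (ne refl)
⁅⁆∪⁅⁆⊆? zero (suc j) (s ∷ S) ne = trans (⊆?-∷ true s (⊥ ∪ ⁅ j ⁆) S) (cong (s ∧_) (trans (cong (λ Z → does (Z ⊆? S)) (∪-identityˡ ⁅ j ⁆)) (⁅⁆⊆? j S)))
⁅⁆∪⁅⁆⊆? (suc i) zero (s ∷ S) ne = trans (⊆?-∷ true s (⁅ i ⁆ ∪ ⊥) S) (trans (cong (s ∧_) (trans (cong (λ Z → does (Z ⊆? S)) (∪-identityʳ ⁅ i ⁆)) (⁅⁆⊆? i S))) (BP.∧-comm s (lookup S i)))
⁅⁆∪⁅⁆⊆? (suc i) (suc j) (s ∷ S) ne = trans (⊆?-∷ false s (⁅ i ⁆ ∪ ⁅ j ⁆) S) (⁅⁆∪⁅⁆⊆? i j S (λ e → ne (cong suc e)))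

∣⁅⁆∪⁅⁆∣≡2 : ∀ {n} (i j : Fin n) → ¬ i ≡ j → ∣ ⁅ i ⁆ ∪ ⁅ j ⁆ ∣ ≡ 2
∣⁅⁆∪⁅⁆∣≡2 zero zero ne = ⊥-elim (ne refl)
∣⁅⁆∪⁅⁆∣≡2 zero (suc j) ne = cong suc (trans (cong ∣_∣ (∪-identityˡ ⁅ j ⁆)) (∣⁅x⁆∣≡1 j))
∣⁅⁆∪⁅⁆∣≡2 (suc i) zero ne = cong suc (trans (cong ∣_∣ (∪-identityʳ ⁅ i ⁆)) (∣⁅x⁆∣≡1 i))
∣⁅⁆∪⁅⁆∣≡2 (suc i) (suc j) ne = ∣⁅⁆∪⁅⁆∣≡2 i j (λ e → ne (cong suc e))

binom-pos : ∀ r k → k ℕ.≤ r → 0 ℕ.< binom r k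
binom-pos r zero h = ℕ.s≤s ℕ.z≤n
binom-pos (suc r) (suc k) (ℕ.s≤s h) = ℕP.<-≤-trans (binom-pos r k h) (ℕP.m≤m+n _ _)

module _ {n : ℕ} (k : ℕ) (X : Subset n) where
  kSubsets : List (Subset n)
  kSubsets = kSubsetsOf k X

  sum-kSubsets : ∀ f → Σ kSubsets f ≡ Σ (allSubsets n) (λ S → if does (∣ S ∣ ℕP.≟ k) ∧ does (S ⊆? X) then f S else 0ℚ)
  sum-kSubsets f = sum-filter _ (allSubsets n) f

  sum-kSubsets-⊇ : ∀ A → Σ kSubsets (λ S → ind (does (A ⊆? S))) ≡ #supersets n k X A
  sum-kSubsets-⊇ A = sum-kSubsets _

  length-kSubsets : fromℕ (length kSubsets) ≡ #supersets n k X ⊥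
  length-kSubsets = trans (length-filter _ (allSubsets n)) (sum-cong (allSubsets n) (λ S → lem (does (∣ S ∣ ℕP.≟ k)) (does (S ⊆? X)) (does (⊥ ⊆? S)) (⊥⊆? S)))
    where
    lem : ∀ b1 b2 b3 → b3 ≡ true → ind (b1 ∧ b2) ≡ guardedInd b1 b2 b3
    lem true true b3 refl = refl
    lem true false b3 e = refl
    lem false b2 b3 e = refl

  length-kSubsets≡binom : ∀ x → ∣ X ∣ ≡ x → length kSubsets ≡ binom x k
  length-kSubsets≡binom x hx = fromℕ-injective (trans length-kSubsets (#supersets≡binom X ⊥ 0 x k k (⊥⊆? X) (∣⊥∣≡0 n) hx refl))

  sum-kSubsets-∋ : ∀ w → Σ kSubsets (λ S → ind (lookup S w)) ≡ #supersets n k X ⁅ w ⁆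
  sum-kSubsets-∋ w = trans (sum-cong kSubsets (λ S → cong ind (sym (⁅⁆⊆? w S)))) (sum-kSubsets-⊇ ⁅ w ⁆)

  sum-kSubsets-∋∋ : ∀ i j → ¬ i ≡ j → Σ kSubsets (λ S → ind (lookup S i ∧ lookup S j)) ≡ #supersets n k X (⁅ i ⁆ ∪ ⁅ j ⁆)
  sum-kSubsets-∋∋ i j ne = trans (sum-cong kSubsets (λ S → cong ind (sym (⁅⁆∪⁅⁆⊆? i j S ne)))) (sum-kSubsets-⊇ (⁅ i ⁆ ∪ ⁅ j ⁆))

eqF-refl : ∀ {n} (a : Fin n) → eqF a a ≡ true
eqF-refl a with a FP.≟ a
... | yes _ = refl
... | no ne = ⊥-elim (ne refl)

eqF-false : ∀ {n} {a b : Fin n} → ¬ a ≡ b → eqF a b ≡ false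
eqF-false {a = a} {b} ne with a FP.≟ b
... | yes e = ⊥-elim (ne e)
... | no _ = refl

eqF-suc : ∀ {n} (a b : Fin n) → eqF (suc a) (suc b) ≡ eqF a b
eqF-suc a b with a FP.≟ b
... | yes refl = refl
... | no ne = refl

eqF-true : ∀ {n} {a b : Fin n} → eqF a b ≡ true → a ≡ b
eqF-true {a = a} {b} e with a FP.≟ b
... | yes p = p
eqF-true {a = a} {b} () | no _

∣∣≡Σind : ∀ {n} (X : Subset n) → fromℕ ∣ X ∣ ≡ ΣV n (λ v → ind (lookup X v))
∣∣≡Σind [] = refl
∣∣≡Σind {suc n} (true ∷ X) = trans (fromℕ-+ 1 ∣ X ∣) (trans (cong (1ℚ +_) (∣∣≡Σind X)) (sym (ΣV-suc n (λ v → ind (lookup (true ∷ X) v)))))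
∣∣≡Σind {suc n} (false ∷ X) = trans (∣∣≡Σind X) (trans (sym (QP.+-identityˡ _)) (sym (ΣV-suc n (λ v → ind (lookup (false ∷ X) v)))))

∣∣≡Σind-ext : ∀ {n} (X : Subset n) (φ : Fin n → Bool) → (∀ v → lookup X v ≡ φ v) → fromℕ ∣ X ∣ ≡ ΣV n (λ v → ind (φ v))
∣∣≡Σind-ext {n} X φ e = trans (∣∣≡Σind X) (sum-cong (allFin n) (λ v → cong ind (e v)))

ΣV-δ : ∀ {n} (a : Fin n) (g : Fin n → ℚ) → ΣV n (λ v → ind (eqF a v) * g v) ≡ g a
ΣV-δ {suc n} zero g = trans (ΣV-suc n (λ v → ind (eqF zero v) * g v)) (trans (cong₂ _+_ (QP.*-identityˡ (g zero)) (trans (sum-cong (allFin n) (λ v → QP.*-zeroˡ (g (suc v)))) (sum-0 (allFin n)))) (QP.+-identityʳ (g zero)))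
ΣV-δ {suc n} (suc a) g = trans (ΣV-suc n (λ v → ind (eqF (suc a) v) * g v))
  (trans (trans (cong (λ z → z + ΣV n (λ v → ind (eqF (suc a) (suc v)) * g (suc v))) (QP.*-zeroˡ (g zero))) (QP.+-identityˡ _))
    (trans (sum-cong (allFin n) (λ v → cong (λ b → ind b * g (suc v)) (eqF-suc a v))) (ΣV-δ a (g ∘ suc))))

sum-strict : ∀ {A : Set} {xs : List A} {f g : A → ℚ} → All (λ x → f x Q.≤ g x) xs → Any (λ x → f x Q.< g x) xs → Σ xs f Q.< Σ xs g
sum-strict (p ∷ ps) (here q) = QP.+-mono-<-≤ q (sum-mono ps)
sum-strict (p ∷ ps) (there q) = QP.+-mono-≤-< p (sum-strict ps q)

growsAt : ∀ {n} → Subset n → Fin n → Edge n → Bool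
growsAt X v (a , b) = (eqF a v ∧ lookup X b) ∨ (eqF b v ∧ lookup X a)

lookup-growStep : ∀ {n} (K : List (Edge n)) (X : Subset n) v → lookup (growStep K X) v ≡ lookup X v ∨ any (growsAt X v) K
lookup-growStep K X v = VP.lookup∘tabulate _ v

Subset-ext : ∀ {n} (X Y : Subset n) → (∀ v → lookup X v ≡ lookup Y v) → X ≡ Y
Subset-ext X Y e = trans (sym (VP.tabulate∘lookup X)) (trans (VP.tabulate-cong e) (VP.tabulate∘lookup Y))

growStep-[] : ∀ {n} (X : Subset n) → growStep [] X ≡ X
growStep-[] X = Subset-ext _ X (λ v → trans (lookup-growStep [] X v) (BP.∨-identityʳ _))

iter-fixed : ∀ {A : Set} (f : A → A) (x : A) → f x ≡ x → ∀ m → iter m f x ≡ x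
iter-fixed f x e zero = refl
iter-fixed f x e (suc m) = trans (cong f (iter-fixed f x e m)) e

componentsMeeting-[] : ∀ {n} (S : Subset n) → componentsMeeting [] S ≡ S
componentsMeeting-[] {n} S = iter-fixed (growStep []) S (growStep-[] S) n

module SingleEdge {n : ℕ} (a b : Fin n) (ab : ¬ a ≡ b) (S : Subset n) where
  grown : Subset n
  grown = growStep ((a , b) ∷ []) S

  lookup-grow : ∀ v → lookup grown v ≡ lookup S v ∨ ((eqF a v ∧ lookup S b) ∨ (eqF b v ∧ lookup S a))
  lookup-grow v = trans (lookup-growStep ((a , b) ∷ []) S v) (cong (lookup S v ∨_) (BP.∨-identityʳ _))

  lookup-grow-a : lookup grown a ≡ lookup S a ∨ lookup S b
  lookup-grow-a rewrite lookup-grow a | eqF-refl a | eqF-false {a = b} {a} (λ e → ab (sym e)) with lookup S a | lookup S b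
  ... | true | _ = refl
  ... | false | true = refl
  ... | false | false = refl

  lookup-grow-b : lookup grown b ≡ lookup S a ∨ lookup S b
  lookup-grow-b rewrite lookup-grow b | eqF-refl b | eqF-false ab with lookup S a | lookup S b
  ... | true | true = refl
  ... | true | false = refl
  ... | false | true = refl
  ... | false | false = refl

  grow-fixed : growStep ((a , b) ∷ []) grown ≡ grown
  grow-fixed = Subset-ext _ grown λ v → trans (lookup-growStep ((a , b) ∷ []) grown v) (trans (cong (lookup grown v ∨_) (BP.∨-identityʳ _)) (pt v))
    where
    pt : ∀ v → lookup grown v ∨ ((eqF a v ∧ lookup grown b) ∨ (eqF b v ∧ lookup grown a)) ≡ lookup grown v
    pt v with eqF a v in ea | eqF b v in eb
    ... | false | false = BP.∨-identityʳ _
    ... | true | true = ⊥-elim (ab (trans (eqF-true ea) (sym (eqF-true eb))))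
    ... | true | false rewrite sym (eqF-true ea) | lookup-grow-a | lookup-grow-b with lookup S a | lookup S b
    ... | true | _ = refl
    ... | false | true = refl
    ... | false | false = refl
    pt v | false | true rewrite sym (eqF-true eb) | lookup-grow-a | lookup-grow-b with lookup S a | lookup S b
    ... | true | _ = refl
    ... | false | true = refl
    ... | false | false = refl

  componentsMeeting-single : componentsMeeting ((a , b) ∷ []) S ≡ grown
  componentsMeeting-single = go n (ℕP.≤-<-trans ℕ.z≤n (FP.toℕ<n a))
    where
    go : ∀ m → 0 ℕ.< m → iter m (growStep ((a , b) ∷ [])) S ≡ grown
    go (suc zero) _ = refl
    go (suc (suc m)) _ = trans (cong (growStep ((a , b) ∷ [])) (go (suc m) (ℕ.s≤s ℕ.z≤n))) grow-fixed

  size-componentsMeeting-single : fromℕ ∣ componentsMeeting ((a , b) ∷ []) S ∣ ≡ fromℕ ∣ S ∣ + ind (lookup S a xor lookup S b)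
  size-componentsMeeting-single = begin
    fromℕ ∣ componentsMeeting ((a , b) ∷ []) S ∣ ≡⟨ cong (λ Z → fromℕ ∣ Z ∣) componentsMeeting-single ⟩
    fromℕ ∣ grown ∣ ≡⟨ ∣∣≡Σind-ext grown _ lookup-grow ⟩
    ΣV n (λ v → ind (lookup S v ∨ ((eqF a v ∧ lookup S b) ∨ (eqF b v ∧ lookup S a))))
      ≡⟨ sum-cong (allFin n) pw ⟩
    ΣV n (λ v → ind (lookup S v) + (ind (eqF a v) * ind (not (lookup S a) ∧ lookup S b) + ind (eqF b v) * ind (not (lookup S b) ∧ lookup S a)))
      ≡⟨ trans (sum-+ (allFin n) _ _) (cong (ΣV n (λ v → ind (lookup S v)) +_) (trans (sum-+ (allFin n) _ _) (cong₂ _+_ (ΣV-δ a _) (ΣV-δ b _)))) ⟩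
    ΣV n (λ v → ind (lookup S v)) + (ind (not (lookup S a) ∧ lookup S b) + ind (not (lookup S b) ∧ lookup S a))
      ≡⟨ cong₂ _+_ (sym (∣∣≡Σind S)) (fin (lookup S a) (lookup S b)) ⟩
    fromℕ ∣ S ∣ + ind (lookup S a xor lookup S b) ∎
    where
    open ≡-Reasoning
    fin : ∀ x y → ind (not x ∧ y) + ind (not y ∧ x) ≡ ind (x xor y)
    fin true true = refl
    fin true false = refl
    fin false true = refl
    fin false false = refl
    pw : ∀ v → ind (lookup S v ∨ ((eqF a v ∧ lookup S b) ∨ (eqF b v ∧ lookup S a))) ≡
               ind (lookup S v) + (ind (eqF a v) * ind (not (lookup S a) ∧ lookup S b) + ind (eqF b v) * ind (not (lookup S b) ∧ lookup S a))
    L00 : ∀ s x y → ind (s ∨ ((false ∧ y) ∨ (false ∧ x))) ≡ ind s + (ind false * ind (not x ∧ y) + ind false * ind (not y ∧ x))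
    L00 true true true = refl
    L00 true true false = refl
    L00 true false true = refl
    L00 true false false = refl
    L00 false true true = refl
    L00 false true false = refl
    L00 false false true = refl
    L00 false false false = refl
    L10 : ∀ x y → ind (x ∨ ((true ∧ y) ∨ (false ∧ x))) ≡ ind x + (ind true * ind (not x ∧ y) + ind false * ind (not y ∧ x))
    L10 true true = refl
    L10 true false = refl
    L10 false true = refl
    L10 false false = refl
    L01 : ∀ x y → ind (y ∨ ((false ∧ y) ∨ (true ∧ x))) ≡ ind y + (ind false * ind (not x ∧ y) + ind true * ind (not y ∧ x))
    L01 true true = refl
    L01 true false = refl
    L01 false true = refl
    L01 false false = refl
    pw v with eqF a v in ea | eqF b v in eb
    ... | false | false = L00 (lookup S v) (lookup S a) (lookup S b)
    ... | true | true = ⊥-elim (ab (trans (eqF-true ea) (sym (eqF-true eb))))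
    ... | true | false rewrite sym (eqF-true ea) = L10 (lookup S a) (lookup S b)
    ... | false | true rewrite sym (eqF-true eb) = L01 (lookup S a) (lookup S b)

true≢false : ¬ true ≡ false
true≢false ()

∨-true-l : ∀ {a} b → a ≡ true → a ∨ b ≡ true
∨-true-l b refl = refl
∨-true-r : ∀ a {b} → b ≡ true → a ∨ b ≡ true
∨-true-r true refl = refl
∨-true-r false refl = refl

any-∈ : ∀ {A : Set} (p : A → Bool) {x} (K : List A) → x ∈ K → p x ≡ true → any p K ≡ true
any-∈ p (y ∷ K) (here refl) e = ∨-true-l _ e
any-∈ p (y ∷ K) (there m) e = ∨-true-r (p y) (any-∈ p K m e)

any-false : ∀ {A : Set} (p q : A → Bool) (K : List A) → (∀ x → q x ≡ true → p x ≡ true) → any p K ≡ false → any q K ≡ false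
any-false p q [] h e = refl
any-false p q (x ∷ K) h e with p x in px | q x in qx
... | false | false = any-false p q K h e
... | true | _ = ⊥-elim (true≢false e)
... | false | true = ⊥-elim (true≢false (trans (sym (h x qx)) px))

any-true : ∀ {A : Set} (p : A → Bool) (K : List A) → any p K ≡ true → ∃ λ x → x ∈ K × p x ≡ true
any-true p (x ∷ K) e with p x in px
... | true = x , here refl , px
... | false with any-true p K e
... | y , m , py = y , there m , py

incident : ∀ {n} → Fin n → Edge n → Bool
incident v (a , b) = eqF a v ∨ eqF b v

isolated : ∀ {n} → List (Edge n) → Fin n → Bool
isolated K v = not (any (incident v) K)

module Closure {n : ℕ} (K : List (Edge n)) (S : Subset n) where
  f : Subset n → Subset n
  f = growStep K
  cl : Subset n
  cl = componentsMeeting K S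

  growStep-inflationary : ∀ X v → lookup X v ≡ true → lookup (f X) v ≡ true
  growStep-inflationary X v e = trans (lookup-growStep K X v) (∨-true-l (any (growsAt X v) K) e)

  seeds⊆iter : ∀ m v → lookup S v ≡ true → lookup (iter m f S) v ≡ true
  seeds⊆iter zero v e = e
  seeds⊆iter (suc m) v e = growStep-inflationary (iter m f S) v (seeds⊆iter m v e)

  isolated-stays-out : ∀ v → isolated K v ≡ true → lookup S v ≡ false → ∀ m → lookup (iter m f S) v ≡ false
  isolated-stays-out v iso sv zero = sv
  isolated-stays-out v iso sv (suc m) = trans (lookup-growStep K (iter m f S) v) (trans (cong (λ z → z ∨ any (growsAt (iter m f S) v) K) (isolated-stays-out v iso sv m))
    (any-false (incident v) (growsAt (iter m f S) v) K hh (trans (sym (BP.not-involutive _)) (cong not iso))))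
    where
    hh : ∀ e → growsAt (iter m f S) v e ≡ true → incident v e ≡ true
    hh (a , b) q with eqF a v | eqF b v
    ... | true | _ = refl
    ... | false | true = refl
    ... | false | false = q

  growStep-strict : ∀ X → ¬ f X ≡ X → ∣ X ∣ ℕ.< ∣ f X ∣
  growStep-strict X ne = ℕP.≰⇒> (λ le → QP.<-irrefl refl (QP.<-≤-trans lt (fromℕ-mono-≤ le)))
    where
    ex : ∃ λ v → ¬ lookup (f X) v ≡ lookup X v
    ex = FP.¬∀⟶∃¬ n _ (λ v → lookup (f X) v BP.≟ lookup X v) (λ h → ne (Subset-ext _ _ h))
    v = proj₁ ex
    fv : lookup (f X) v ≡ true × lookup X v ≡ false
    fv with lookup X v in xv | lookup (f X) v in fxv
    ... | true | _ = ⊥-elim (proj₂ ex (trans (growStep-inflationary X v xv) (sym xv)))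
    ... | false | true = refl , refl
    ... | false | false = ⊥-elim (proj₂ ex (trans fxv (sym xv)))
    pw : All (λ u → ind (lookup X u) Q.≤ ind (lookup (f X) u)) (allFin n)
    pw = All.universal (λ u → lem u) (allFin n)
      where
      lem : ∀ u → ind (lookup X u) Q.≤ ind (lookup (f X) u)
      lem u with lookup X u in xu
      ... | true rewrite growStep-inflationary X u xu = QP.≤-refl
      ... | false = ind≥0 (lookup (f X) u)
    st : Any (λ u → ind (lookup X u) Q.< ind (lookup (f X) u)) (allFin n)
    st = Any.map (λ { refl → subst₂ (λ a b → ind a Q.< ind b) (sym (proj₂ fv)) (sym (proj₁ fv)) (fromℕ-suc-pos 0) }) (∈-allFin v)
    lt : fromℕ ∣ X ∣ Q.< fromℕ ∣ f X ∣
    lt = subst₂ Q._<_ (sym (∣∣≡Σind X)) (sym (∣∣≡Σind (f X))) (sum-strict pw st)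

  growth-stage : 1 ℕ.≤ ∣ S ∣ → ∀ m → (f (iter m f S) ≡ iter m f S) ⊎ (suc m ℕ.≤ ∣ iter m f S ∣)
  growth-stage h zero = inj₂ h
  growth-stage h (suc m) with growth-stage h m
  ... | inj₁ fx = inj₁ (cong f fx)
  ... | inj₂ sz with VP.≡-dec BP._≟_ (f (iter m f S)) (iter m f S)
  ... | yes fx = inj₁ (cong f fx)
  ... | no nfx = inj₂ (ℕP.<-≤-trans (ℕ.s≤s sz) (growStep-strict _ nfx))

  closure-fixed : 1 ℕ.≤ ∣ S ∣ → f cl ≡ cl
  closure-fixed h with growth-stage h n
  ... | inj₁ fx = fx
  ... | inj₂ sz = ⊥-elim (ℕP.<-irrefl refl (ℕP.<-≤-trans sz (∣p∣≤n cl)))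

  closure-closed : 1 ℕ.≤ ∣ S ∣ → ∀ a b → (a , b) ∈ K → (lookup cl a ≡ true → lookup cl b ≡ true) × (lookup cl b ≡ true → lookup cl a ≡ true)
  closure-closed h a b m = (λ ca → trans (cong (λ Z → lookup Z b) (sym (closure-fixed h))) (trans (lookup-growStep K cl b) (∨-true-r _ (any-∈ (growsAt cl b) K m (∨-true-r _ (trans (cong (_∧ lookup cl a) (eqF-refl b)) ca))))))
                 , (λ cb → trans (cong (λ Z → lookup Z a) (sym (closure-fixed h))) (trans (lookup-growStep K cl a) (∨-true-r _ (any-∈ (growsAt cl a) K m (∨-true-l _ (trans (cong (_∧ lookup cl b) (eqF-refl a)) cb))))))

T⇒≡true : ∀ {b} → T b → b ≡ true
T⇒≡true {true} _ = refl

module _ {n : ℕ} (G : Graph n) where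
  isListedFrom? : (i : Fin n) → Decidable (λ j → toℕ i ℕ.< toℕ j × T (adj G i j))
  isListedFrom? i j = toℕ i ℕP.<? toℕ j ×-dec B.T? (adj G i j)

  IsEdge : Edge n → Set
  IsEdge e = adj G (proj₁ e) (proj₂ e) ≡ true × toℕ (proj₁ e) ℕ.< toℕ (proj₂ e)

  edges-IsEdge : All IsEdge (edges G)
  edges-IsEdge = All-concatMap {n = n} {P = IsEdge} (λ i → map (λ j → (i , j)) (filter (isListedFrom? i) (allFin n))) (allFin n) (All.universal (λ i → map⁺ (All.map (λ { (lt , t) → T⇒≡true t , lt }) (all-filter (isListedFrom? i) (allFin n)))) (allFin n))

  edge-ends-distinct : ∀ {e} → IsEdge e → ¬ proj₁ e ≡ proj₂ e
  edge-ends-distinct (_ , lt) eq = ℕP.<-irrefl (cong toℕ eq) lt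

  listed : Fin n → Fin n → Bool
  listed i j = does (toℕ i ℕP.<? toℕ j) ∧ adj G i j

  deg≡Σadj : ∀ i → fromℕ (deg G i) ≡ ΣV n (λ j → ind (adj G i j))
  deg≡Σadj i = length-filter (λ j → B.T? (adj G i j)) (allFin n)

  listedEdge-symmetrise : ∀ i j → ind (listed i j) + ind (listed j i) ≡ ind (adj G i j)
  listedEdge-symmetrise i j with ℕP.<-cmp (toℕ i) (toℕ j)
  ... | tri< lt _ ge rewrite dec-true (toℕ i ℕP.<? toℕ j) lt | dec-false (toℕ j ℕP.<? toℕ i) ge = QP.+-identityʳ _
  ... | tri> le _ gt rewrite dec-false (toℕ i ℕP.<? toℕ j) le | dec-true (toℕ j ℕP.<? toℕ i) gt | gsym G j i = QP.+-identityˡ _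
  ... | tri≈ le eq ge rewrite FP.toℕ-injective eq | irrefl G j | dec-false (toℕ j ℕP.<? toℕ j) ge = refl

  if-+ : ∀ b (x y : ℚ) → (if b then x + y else 0ℚ) ≡ ind b * x + ind b * y
  if-+ true x y = sym (cong₂ _+_ (QP.*-identityˡ x) (QP.*-identityˡ y))
  if-+ false x y = sym (trans (cong₂ _+_ (QP.*-zeroˡ x) (QP.*-zeroˡ y)) refl)

  handshake : ∀ (h : Fin n → ℚ) → Σ (edges G) (λ e → h (proj₁ e) + h (proj₂ e)) ≡ ΣV n (λ v → h v * fromℕ (deg G v))
  handshake h = begin
    Σ (edges G) F
      ≡⟨ sum-concatMap (allFin n) (λ i → map (λ j → (i , j)) (filter (isListedFrom? i) (allFin n))) F ⟩
    ΣV n (λ i → Σ (map (λ j → (i , j)) (filter (isListedFrom? i) (allFin n))) F)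
      ≡⟨ sum-cong (allFin n) (λ i → trans (sum-map (filter (isListedFrom? i) (allFin n)) (λ j → (i , j)) F) (sum-filter (isListedFrom? i) (allFin n) (λ j → h i + h j))) ⟩
    ΣV n (λ i → ΣV n (λ j → if listed i j then h i + h j else 0ℚ))
      ≡⟨ sum-cong (allFin n) (λ i → trans (sum-cong (allFin n) (λ j → if-+ (listed i j) (h i) (h j))) (sum-+ (allFin n) (λ j → ind (listed i j) * h i) (λ j → ind (listed i j) * h j))) ⟩
    ΣV n (λ i → ΣV n (λ j → ind (listed i j) * h i) + ΣV n (λ j → ind (listed i j) * h j))
      ≡⟨ sum-+ (allFin n) (λ i → ΣV n (λ j → ind (listed i j) * h i)) (λ i → ΣV n (λ j → ind (listed i j) * h j)) ⟩
    ΣV n (λ i → ΣV n (λ j → ind (listed i j) * h i)) + ΣV n (λ i → ΣV n (λ j → ind (listed i j) * h j))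
      ≡⟨ cong (ΣV n (λ i → ΣV n (λ j → ind (listed i j) * h i)) +_) (sum-swap (allFin n) (allFin n) (λ i j → ind (listed i j) * h j)) ⟩
    ΣV n (λ i → ΣV n (λ j → ind (listed i j) * h i)) + ΣV n (λ j → ΣV n (λ i → ind (listed i j) * h j))
      ≡⟨ sym (sum-+ (allFin n) (λ i → ΣV n (λ j → ind (listed i j) * h i)) (λ i → ΣV n (λ j → ind (listed j i) * h i))) ⟩
    ΣV n (λ i → ΣV n (λ j → ind (listed i j) * h i) + ΣV n (λ j → ind (listed j i) * h i))
      ≡⟨ sum-cong (allFin n) (λ i → trans (sym (sum-+ (allFin n) (λ j → ind (listed i j) * h i) (λ j → ind (listed j i) * h i)))
           (trans (sum-cong (allFin n) (λ j → trans (sym (QP.*-distribʳ-+ (h i) (ind (listed i j)) (ind (listed j i)))) (cong (_* h i) (listedEdge-symmetrise i j))))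
             (trans (sum-*ʳ (allFin n) (h i) (λ j → ind (adj G i j))) (trans (cong (_* h i) (sym (deg≡Σadj i))) (QP.*-comm _ (h i)))))) ⟩
    ΣV n (λ v → h v * fromℕ (deg G v)) ∎
    where
    open ≡-Reasoning
    F : Edge n → ℚ
    F e = h (proj₁ e) + h (proj₂ e)

lookup-⁅⁆ : ∀ {n} (w u : Fin n) → lookup ⁅ w ⁆ u ≡ eqF w u
lookup-⁅⁆ zero zero = refl
lookup-⁅⁆ {suc n} zero (suc u) = VP.lookup-replicate u false
lookup-⁅⁆ (suc w) zero = refl
lookup-⁅⁆ (suc w) (suc u) = trans (lookup-⁅⁆ w u) (sym (eqF-suc w u))

eqF-sym : ∀ {n} (a b : Fin n) → eqF a b ≡ eqF b a
eqF-sym a b with a FP.≟ b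
... | yes refl = sym (eqF-refl a)
... | no ne = sym (eqF-false (λ e → ne (sym e)))

Nonempty-witness : ∀ {n} (X : Subset n) → 1 ℕ.≤ ∣ X ∣ → ∃ λ s → lookup X s ≡ true
Nonempty-witness (true ∷ X) h = zero , refl
Nonempty-witness (false ∷ X) h with Nonempty-witness X h
... | s , e = suc s , e

xor-swap : ∀ a b c d → (a xor b) ≡ (c xor d) → (a xor c) ≡ (b xor d)
xor-swap true true true true e = refl
xor-swap true true true false ()
xor-swap true true false true ()
xor-swap true true false false e = refl
xor-swap true false true true ()
xor-swap true false true false e = refl
xor-swap true false false true e = refl
xor-swap true false false false ()
xor-swap false true true true ()
xor-swap false true true false e = refl
xor-swap false true false true e = refl
xor-swap false true false false ()
xor-swap false false true true e = refl
xor-swap false false true false ()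
xor-swap false false false true ()
xor-swap false false false false e = refl

module _ {n : ℕ} (G : Graph n) where
  incident-count≡deg : ∀ w → length (filter (B.T? ∘ incident w) (edges G)) ≡ deg G w
  incident-count≡deg w = fromℕ-injective (begin
    fromℕ (length (filter (B.T? ∘ incident w) (edges G))) ≡⟨ length-filter (B.T? ∘ incident w) (edges G) ⟩
    Σ (edges G) (λ e → ind (incident w e)) ≡⟨ sum-congAll (All.map pw (edges-IsEdge G)) ⟩
    Σ (edges G) (λ e → ind (eqF (proj₁ e) w) + ind (eqF (proj₂ e) w)) ≡⟨ handshake G (λ u → ind (eqF u w)) ⟩
    ΣV n (λ v → ind (eqF v w) * fromℕ (deg G v)) ≡⟨ sum-cong (allFin n) (λ v → cong (λ b → ind b * fromℕ (deg G v)) (eqF-sym v w)) ⟩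
    ΣV n (λ v → ind (eqF w v) * fromℕ (deg G v)) ≡⟨ ΣV-δ w (λ v → fromℕ (deg G v)) ⟩
    fromℕ (deg G w) ∎)
    where
    open ≡-Reasoning
    pw : ∀ {e} → IsEdge G e → ind (incident w e) ≡ ind (eqF (proj₁ e) w) + ind (eqF (proj₂ e) w)
    pw {a , b} ok with eqF a w in ea | eqF b w in eb
    ... | true | true = ⊥-elim (edge-ends-distinct G ok (trans (eqF-true ea) (sym (eqF-true eb))))
    ... | true | false = sym (QP.+-identityʳ 1ℚ)
    ... | false | true = sym (QP.+-identityˡ 1ℚ)
    ... | false | false = refl

  isolated⇒deg≤nLost : ∀ c → LostBound (edges G) c → ∀ v → isolated (Config.kept c) v ≡ true → deg G v ℕ.≤ Config.nLost c
  isolated⇒deg≤nLost c cc v iso = subst (ℕ._≤ Config.nLost c) (incident-count≡deg v) (cc (λ e → T (incident v e)) (B.T? ∘ incident v)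
    (λ e _ t m → true≢false (trans (sym (any-∈ (incident v) (Config.kept c) m (T⇒≡true t))) (trans (sym (BP.not-involutive _)) (cong not iso)))))

  -- The complement U of the cluster is a cut with at most d edges, hence by (*) the star
  -- of a vertex w; then [u ∉ cluster] xor [u = w] is constant along edges, hence constant,
  -- so the cluster misses at most w, and only if w is isolated and not a seed.
  module FewLostEdges (d : ℕ) (P* : Property* G d) (conn : Connected G) (c : Config n)
              (vc : ConfigOf (edges G) c) (cc : LostBound (edges G) c) (nl : Config.nLost c ℕ.≤ d) (S : Subset n) (S2 : 2 ℕ.≤ ∣ S ∣) where
    K : List (Edge n)
    K = Config.kept c
    open Closure K S
    1≤∣S∣ : 1 ℕ.≤ ∣ S ∣
    1≤∣S∣ = ℕP.≤-trans (ℕP.n≤1+n 1) S2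

    kept⊆edges : ∀ e → e ∈ K → e ∈ edges G
    kept⊆edges e m = proj₂ (proj₂ vc) e m

    U : Subset n
    U = tabulate (λ u → not (lookup cl u))
    lookup-U : ∀ u → lookup U u ≡ not (lookup cl u)
    lookup-U u = VP.lookup∘tabulate _ u

    cluster-closed-under-K : ∀ a b → (a , b) ∈ K → lookup cl a ≡ lookup cl b
    cluster-closed-under-K a b m with lookup cl a in ca | lookup cl b in cb
    ... | true | true = refl
    ... | false | false = refl
    ... | true | false = ⊥-elim (true≢false (trans (sym (proj₁ (closure-closed 1≤∣S∣ a b m) ca)) cb))
    ... | false | true = ⊥-elim (true≢false (trans (sym (proj₂ (closure-closed 1≤∣S∣ a b m) cb)) ca))

    cutSize-U≤d : cutSize G U ℕ.≤ d
    cutSize-U≤d = ℕP.≤-trans (cc (λ e → T (crosses U (proj₁ e) (proj₂ e))) (λ e → B.T? (crosses U (proj₁ e) (proj₂ e)))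
             (λ { (a , b) _ t m → nx a b (cluster-closed-under-K a b m) t })) nl
      where
      nx : ∀ a b → lookup cl a ≡ lookup cl b → ¬ T (crosses U a b)
      nx a b e t rewrite lookup-U a | lookup-U b | e with lookup cl b
      nx a b e () | true
      nx a b e () | false

    seeds⊆cluster : ∀ v → lookup S v ≡ true → lookup cl v ≡ true
    seeds⊆cluster v = seeds⊆iter n v

    module Outside (v : Fin n) (clv : lookup cl v ≡ false) where
      U-nonempty : Nonempty U
      U-nonempty = v , VP.lookup⇒[]= v U (trans (lookup-U v) (cong not clv))
      seed : Fin n
      seed = proj₁ (Nonempty-witness S 1≤∣S∣)
      seed∈S : lookup S seed ≡ true
      seed∈S = proj₂ (Nonempty-witness S 1≤∣S∣)
      ∁U-nonempty : Nonempty (∁ U)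
      ∁U-nonempty = seed , VP.lookup⇒[]= seed (∁ U) (trans (VP.lookup-map seed not U) (trans (cong not (lookup-U seed)) (trans (BP.not-involutive _) (seeds⊆cluster seed seed∈S))))
      star : ∃ λ w → deg G w ≡ d × (∀ i j → adj G i j ≡ true → crosses U i j ≡ crosses ⁅ w ⁆ i j)
      star = proj₂ (proj₂ P*) U U-nonempty ∁U-nonempty cutSize-U≤d
      w : Fin n
      w = proj₁ star
      star-cut : ∀ i j → adj G i j ≡ true → crosses U i j ≡ crosses ⁅ w ⁆ i j
      star-cut = proj₂ (proj₂ star)
      outside-xor-w : Fin n → Bool
      outside-xor-w u = not (lookup cl u) xor eqF w u
      outside-xor-w-step : ∀ a b → adj G a b ≡ true → outside-xor-w a ≡ outside-xor-w b
      outside-xor-w-step a b ab = subst₂ _≡_ (cong₂ _xor_ (lookup-U a) (lookup-⁅⁆ w a)) (cong₂ _xor_ (lookup-U b) (lookup-⁅⁆ w b))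
        (xor-swap (lookup U a) (lookup U b) (lookup ⁅ w ⁆ a) (lookup ⁅ w ⁆ b) (star-cut a b ab))
      outside-xor-w-walk : ∀ {a b} → Walk G a b → outside-xor-w a ≡ outside-xor-w b
      outside-xor-w-walk here = refl
      outside-xor-w-walk (step ab wk) = trans (outside-xor-w-step _ _ ab) (outside-xor-w-walk wk)
      outside-xor-w-constant : ∀ u → outside-xor-w u ≡ outside-xor-w w
      outside-xor-w-constant u = sym (outside-xor-w-walk (conn w u))
      outside-xor-w-at-w : outside-xor-w w ≡ lookup cl w
      outside-xor-w-at-w rewrite eqF-refl w with lookup cl w
      ... | true = refl
      ... | false = refl

      w∉cluster : lookup cl w ≡ false
      w∉cluster with lookup cl w in cw
      ... | false = refl
      ... | true = ⊥-elim (ℕP.<-irrefl refl (ℕP.<-≤-trans S2 (fromℕ-cancel-≤ le)))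
        where
        onlyw : ∀ u → lookup S u ≡ true → eqF w u ≡ true
        onlyw u su = trans (cong (λ x → not x xor eqF w u) (sym (seeds⊆cluster u su))) (trans (outside-xor-w-constant u) (trans outside-xor-w-at-w cw))
        pw : ∀ u → ind (lookup S u) Q.≤ ind (eqF w u) * 1ℚ
        pw u with lookup S u in su
        ... | true = subst (λ b → 1ℚ Q.≤ ind b * 1ℚ) (sym (onlyw u su)) (QP.≤-reflexive (sym (QP.*-identityʳ 1ℚ)))
        ... | false = subst (0ℚ Q.≤_) (sym (QP.*-identityʳ _)) (ind≥0 (eqF w u))
        le : fromℕ ∣ S ∣ Q.≤ fromℕ 1
        le = subst₂ Q._≤_ (sym (∣∣≡Σind S)) (ΣV-δ w (λ _ → 1ℚ)) (sum-mono (All.universal pw (allFin n)))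

      v≡w : eqF w v ≡ true
      v≡w = lem (eqF w v) (trans (cong (λ x → not x xor eqF w v) (sym clv)) (trans (outside-xor-w-constant v) (trans outside-xor-w-at-w w∉cluster)))
        where lem : ∀ b → (true xor b) ≡ false → b ≡ true
              lem true _ = refl
              lem false ()

      v-isolated : isolated K v ≡ true
      v-isolated with any (incident v) K in ai
      ... | false = refl
      ... | true = ⊥-elim (bad (any-true (incident v) K ai))
        where
        vw : v ≡ w
        vw = sym (eqF-true v≡w)
        clTrue : ∀ u → ¬ u ≡ w → lookup cl u ≡ true
        clTrue u ne = lem2 (lookup cl u) (trans (cong (λ b → not (lookup cl u) xor b) (sym (eqF-false {a = w} {u} (λ e → ne (sym e))))) (trans (outside-xor-w-constant u) (trans outside-xor-w-at-w w∉cluster)))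
          where lem2 : ∀ x → (not x xor false) ≡ false → x ≡ true
                lem2 true _ = refl
                lem2 false ()
        bad : ¬ (∃ λ e → e ∈ K × incident v e ≡ true)
        bad ((a , b) , m , ie) with eqF a v in ea | eqF b v in eb
        ... | true | _ = true≢false (trans (sym claT) claF)
          where
          ne = edge-ends-distinct G (All.lookup (edges-IsEdge G) (kept⊆edges _ m))
          a≡v = eqF-true ea
          claT = proj₂ (closure-closed 1≤∣S∣ a b m) (clTrue b (λ e → ne (trans a≡v (trans vw (sym e)))))
          claF = trans (cong (lookup cl) a≡v) clv
        ... | false | true = true≢false (trans (sym clbT) clbF)
          where
          ne = edge-ends-distinct G (All.lookup (edges-IsEdge G) (kept⊆edges _ m))
          b≡v = eqF-true eb
          clbT = proj₁ (closure-closed 1≤∣S∣ a b m) (clTrue a (λ e → ne (trans e (sym (trans b≡v vw)))))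
          clbF = trans (cong (lookup cl) b≡v) clv
        ... | false | false = true≢false (sym ie)

      v∉S : lookup S v ≡ false
      v∉S with lookup S v in sv
      ... | false = refl
      ... | true = ⊥-elim (true≢false (trans (sym (seeds⊆cluster v sv)) clv))

    componentsMeeting-few-lost : ∀ v → lookup cl v ≡ not (isolated K v ∧ not (lookup S v))
    componentsMeeting-few-lost v with lookup cl v in clv
    ... | false rewrite Outside.v-isolated v clv | Outside.v∉S v clv = refl
    ... | true with isolated K v in iv | lookup S v in sv
    ... | true | false = ⊥-elim (true≢false (trans (sym clv) (isolated-stays-out v iv sv n)))
    ... | true | true = refl
    ... | false | _ = refl

clusterSize : ∀ {n} → List (Edge n) → Subset n → ℚ
clusterSize K S = fromℕ ∣ componentsMeeting K S ∣

weight : ∀ {n} → ℚ → Config n → ℚ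
weight β c = β ^ℚ Config.nKept c * (1ℚ - β) ^ℚ Config.nLost c

avgSize : ∀ {n} → ℕ → Subset n → List (Edge n) → ℚ
avgSize k X K = Σ (kSubsetsOf k X) (clusterSize K) * frac 1 (length (kSubsetsOf k X))

sizeGap : ∀ {n} → ℕ → Subset n → List (Edge n) → ℚ
sizeGap k C K = avgSize k C K - avgSize k ⊤ K

module _ {n : ℕ} (G : Graph n) (β : ℚ) (k : ℕ) where
  expectedSize-by-config : ∀ X → expectedSize G β k X ≡ Σ (configs (edges G)) (λ c → weight β c * avgSize k X (Config.kept c))
  expectedSize-by-config X = begin
    expectedSize G β k X ≡⟨ cong (λ z → Σ L Ef * frac 1 z) (LP.length-map (expectedSizeFixed G β) L) ⟩
    Σ L Ef * inv ≡⟨ cong (_* inv) (sum-swap L Cs (λ S c → weight β c * clusterSize (Config.kept c) S)) ⟩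
    Σ Cs (λ c → Σ L (λ S → weight β c * clusterSize (Config.kept c) S)) * inv ≡⟨ cong (_* inv) (sum-cong Cs (λ c → sum-*ˡ L (weight β c) (clusterSize (Config.kept c)))) ⟩
    Σ Cs (λ c → weight β c * Σ L (clusterSize (Config.kept c))) * inv ≡⟨ sym (sum-*ʳ Cs inv (λ c → weight β c * Σ L (clusterSize (Config.kept c)))) ⟩
    Σ Cs (λ c → weight β c * Σ L (clusterSize (Config.kept c)) * inv) ≡⟨ sum-cong Cs (λ c → QP.*-assoc (weight β c) _ inv) ⟩
    Σ Cs (λ c → weight β c * avgSize k X (Config.kept c)) ∎
    where
    open ≡-Reasoning
    Cs = configs (edges G)
    L = kSubsetsOf k X
    inv = frac 1 (length L)
    Ef = expectedSizeFixed G β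

  expectedSize-gap : ∀ C → expectedSize G β k C - expectedSize G β k ⊤ ≡ Σ (configs (edges G)) (λ c → weight β c * sizeGap k C (Config.kept c))
  expectedSize-gap C = trans (cong₂ _-_ (expectedSize-by-config C) (expectedSize-by-config ⊤))
    (trans (sym (sum-- (configs (edges G)) _ _)) (sum-cong (configs (edges G)) (λ c → solve 3 (λ w a b → w :* a :- w :* b := w :* (a :- b)) refl (weight β c) (avgSize k C (Config.kept c)) (avgSize k ⊤ (Config.kept c)))))

module UniformKSubsets {n : ℕ} (k : ℕ) (X : Subset n) (r : ℕ) (hr : ∣ X ∣ ≡ r) (k≤r : k ℕ.≤ r) where
  Ls : List (Subset n)
  Ls = kSubsetsOf k X
  N0 : ℕ
  N0 = length Ls
  N0≡ : N0 ≡ binom r k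
  N0≡ = length-kSubsets≡binom k X r hr
  N0pos : 0 ℕ.< N0
  N0pos = subst (0 ℕ.<_) (sym N0≡) (binom-pos r k k≤r)
  inv : ℚ
  inv = frac 1 N0

  N*inv≡1 : fromℕ N0 * inv ≡ 1ℚ
  N*inv≡1 = fromℕ*frac1≡1 N0pos

  allL : All (λ S → ∣ S ∣ ≡ k × S ⊆ X) Ls
  allL = all-filter _ (allSubsets n)

  avg : (Subset n → ℚ) → ℚ
  avg f = Σ Ls f * inv

  avg-const : ∀ c → avg (λ _ → c) ≡ c
  avg-const c = trans (cong (_* inv) (sum-const Ls c)) (trans (solve 3 (λ a b c → (a :* c) :* b := c :* (a :* b)) refl (fromℕ N0) inv c)
    (trans (cong (c *_) N*inv≡1) (QP.*-identityʳ c)))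

  inv≥0 : 0ℚ Q.≤ inv
  inv≥0 = frac-nonneg 1 N0

  avg-bounds : ∀ (f : Subset n → ℚ) (M : ℚ) → (∀ S → 0ℚ Q.≤ f S × f S Q.≤ M) → 0ℚ Q.≤ avg f × avg f Q.≤ M
  avg-bounds f M h = *-nonneg (sum-nonneg (All.universal (λ S → proj₁ (h S)) Ls)) inv≥0 ,
    QP.≤-trans (QP.*-monoʳ-≤-nonNeg inv {{Q.nonNegative inv≥0}} (sum-mono (All.universal (λ S → proj₂ (h S)) Ls)))
      (QP.≤-reflexive (trans (cong (_* inv) (sum-const Ls M)) (trans (solve 3 (λ a b c → (a :* c) :* b := c :* (a :* b)) refl (fromℕ N0) inv M)
    (trans (cong (M *_) N*inv≡1) (QP.*-identityʳ M)))))

  avg-+ : ∀ f g → avg (λ S → f S + g S) ≡ avg f + avg g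
  avg-+ f g = trans (cong (_* inv) (sum-+ Ls f g)) (QP.*-distribʳ-+ inv (Σ Ls f) (Σ Ls g))

  avg-neg : ∀ f → avg (λ S → - f S) ≡ - avg f
  avg-neg f = trans (cong (_* inv) (sum-neg Ls f)) (sym (QP.neg-distribˡ-* (Σ Ls f) inv))

  avg-*ˡ : ∀ c f → avg (λ S → c * f S) ≡ c * avg f
  avg-*ˡ c f = trans (cong (_* inv) (sum-*ˡ Ls c f)) (QP.*-assoc c _ inv)

  avg-cong : ∀ {f g} → All (λ S → f S ≡ g S) Ls → avg f ≡ avg g
  avg-cong h = cong (_* inv) (sum-congAll h)

  inclusion : Fin n → ℚ
  inclusion v = avg (λ S → ind (lookup S v))

  inclusion*r≡ : ∀ k1 r1 → k ≡ suc k1 → r ≡ suc r1 → ∀ v → inclusion v * fromℕ r ≡ ind (lookup X v) * fromℕ k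
  inclusion*r≡ k1 r1 refl refl v with lookup X v in xv
  ... | true = begin
      Σ Ls (λ S → ind (lookup S v)) * inv * fromℕ r ≡⟨ cong (λ z → z * inv * fromℕ r) (trans (sum-kSubsets-∋ k X v) (#supersets≡binom X ⁅ v ⁆ 1 r1 k1 k (trans (⁅⁆⊆? v X) xv) (∣⁅x⁆∣≡1 v) hr refl)) ⟩
      fromℕ (binom r1 k1) * inv * fromℕ r ≡⟨ solve 3 (λ b i r → b :* i :* r := (r :* b) :* i) refl (fromℕ (binom r1 k1)) inv (fromℕ r) ⟩
      fromℕ r * fromℕ (binom r1 k1) * inv ≡⟨ cong (_* inv) (sym (fromℕ-* r (binom r1 k1))) ⟩
      fromℕ (r ℕ.* binom r1 k1) * inv ≡⟨ cong (λ z → fromℕ z * inv) (sym (binom-absorption r1 k1)) ⟩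
      fromℕ (k ℕ.* binom r k) * inv ≡⟨ cong (λ z → fromℕ (k ℕ.* z) * inv) (sym N0≡) ⟩
      fromℕ (k ℕ.* N0) * inv ≡⟨ cong (_* inv) (fromℕ-* k N0) ⟩
      fromℕ k * fromℕ N0 * inv ≡⟨ trans (QP.*-assoc (fromℕ k) (fromℕ N0) inv) (cong (fromℕ k *_) N*inv≡1) ⟩
      fromℕ k * 1ℚ ≡⟨ QP.*-identityʳ (fromℕ k) ⟩
      fromℕ k ≡⟨ sym (QP.*-identityˡ (fromℕ k)) ⟩
      1ℚ * fromℕ k ∎
    where open ≡-Reasoning
  ... | false = trans (cong (λ z → z * inv * fromℕ r) (trans (sum-kSubsets-∋ k X v) (#supersets-⊈ X ⁅ v ⁆ k (trans (⁅⁆⊆? v X) xv))))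
                  (trans (cong (_* fromℕ r) (QP.*-zeroˡ inv)) (trans (QP.*-zeroˡ (fromℕ r)) (sym (QP.*-zeroˡ (fromℕ k)))))

  pairInclusion : Fin n → Fin n → ℚ
  pairInclusion i j = avg (λ S → ind (lookup S i ∧ lookup S j))

  pairInclusion*rr≡ : ∀ k2 r2 → k ≡ suc (suc k2) → r ≡ suc (suc r2) → ∀ i j → ¬ i ≡ j →
    pairInclusion i j * (fromℕ r * fromℕ (suc r2)) ≡ ind (lookup X i ∧ lookup X j) * (fromℕ k * fromℕ (suc k2))
  pairInclusion*rr≡ k2 r2 refl refl i j ne with lookup X i ∧ lookup X j in xij
  ... | true = begin
      Σ Ls (λ S → ind (lookup S i ∧ lookup S j)) * inv * (fromℕ r * fromℕ (suc r2))
        ≡⟨ cong (λ z → z * inv * (fromℕ r * fromℕ (suc r2))) (trans (sum-kSubsets-∋∋ k X i j ne) (#supersets≡binom X (⁅ i ⁆ ∪ ⁅ j ⁆) 2 r2 k2 k (trans (⁅⁆∪⁅⁆⊆? i j X ne) xij) (∣⁅⁆∪⁅⁆∣≡2 i j ne) hr refl)) ⟩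
      fromℕ (binom r2 k2) * inv * (fromℕ r * fromℕ (suc r2))
        ≡⟨ solve 4 (λ b i r s → b :* i :* (r :* s) := (r :* (s :* b)) :* i) refl (fromℕ (binom r2 k2)) inv (fromℕ r) (fromℕ (suc r2)) ⟩
      fromℕ r * (fromℕ (suc r2) * fromℕ (binom r2 k2)) * inv
        ≡⟨ cong (λ z → fromℕ r * z * inv) (sym (fromℕ-* (suc r2) (binom r2 k2))) ⟩
      fromℕ r * fromℕ (suc r2 ℕ.* binom r2 k2) * inv
        ≡⟨ cong (λ z → fromℕ r * fromℕ z * inv) (sym (binom-absorption r2 k2)) ⟩
      fromℕ r * fromℕ (suc k2 ℕ.* binom (suc r2) (suc k2)) * inv
        ≡⟨ cong (_* inv) (trans (cong (fromℕ r *_) (fromℕ-* (suc k2) (binom (suc r2) (suc k2)))) (solve 3 (λ r a b → r :* (a :* b) := a :* (r :* b)) refl (fromℕ r) (fromℕ (suc k2)) (fromℕ (binom (suc r2) (suc k2))))) ⟩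
      fromℕ (suc k2) * (fromℕ r * fromℕ (binom (suc r2) (suc k2))) * inv
        ≡⟨ cong (λ z → fromℕ (suc k2) * z * inv) (trans (sym (fromℕ-* r (binom (suc r2) (suc k2)))) (trans (cong fromℕ (sym (binom-absorption (suc r2) (suc k2)))) (trans (cong (λ z → fromℕ (k ℕ.* z)) (sym N0≡)) (fromℕ-* k N0)))) ⟩
      fromℕ (suc k2) * (fromℕ k * fromℕ N0) * inv
        ≡⟨ solve 4 (λ a b c d → a :* (b :* c) :* d := (b :* a) :* (c :* d)) refl (fromℕ (suc k2)) (fromℕ k) (fromℕ N0) inv ⟩
      (fromℕ k * fromℕ (suc k2)) * (fromℕ N0 * inv)
        ≡⟨ cong ((fromℕ k * fromℕ (suc k2)) *_) N*inv≡1 ⟩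
      (fromℕ k * fromℕ (suc k2)) * 1ℚ ≡⟨ QP.*-identityʳ _ ⟩
      (fromℕ k * fromℕ (suc k2)) ≡⟨ sym (QP.*-identityˡ _) ⟩
      1ℚ * (fromℕ k * fromℕ (suc k2)) ∎
    where open ≡-Reasoning
  ... | false = trans (cong (λ z → z * inv * (fromℕ r * fromℕ (suc r2))) (trans (sum-kSubsets-∋∋ k X i j ne) (#supersets-⊈ X (⁅ i ⁆ ∪ ⁅ j ⁆) k (trans (⁅⁆∪⁅⁆⊆? i j X ne) xij))))
                  (trans (cong (_* (fromℕ r * fromℕ (suc r2))) (QP.*-zeroˡ inv)) (trans (QP.*-zeroˡ (fromℕ r * fromℕ (suc r2))) (sym (QP.*-zeroˡ (fromℕ k * fromℕ (suc k2))))))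

  avgSize-[] : avgSize k X [] ≡ fromℕ k
  avgSize-[] = trans (avg-cong (All.map (λ { {S} (sk , _) → trans (cong (λ Z → fromℕ ∣ Z ∣) (componentsMeeting-[] S)) (cong fromℕ sk) }) allL)) (avg-const (fromℕ k))

  avgSize-bounds : ∀ K → 0ℚ Q.≤ avgSize k X K × avgSize k X K Q.≤ fromℕ n
  avgSize-bounds K = avg-bounds (clusterSize K) (fromℕ n) (λ S → fromℕ-nonneg ∣ componentsMeeting K S ∣ , fromℕ-mono-≤ (∣p∣≤n (componentsMeeting K S)))

  two : ℚ
  two = fromℕ 2

  ind-xor : ∀ x y → ind (x xor y) ≡ ind x + ind y - two * ind (x ∧ y)
  ind-xor true true = refl
  ind-xor true false = refl
  ind-xor false true = refl
  ind-xor false false = refl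

  avgSize-single : ∀ a b → ¬ a ≡ b → avgSize k X ((a , b) ∷ []) ≡ fromℕ k + (inclusion a + inclusion b - two * pairInclusion a b)
  avgSize-single a b ab = begin
    avg (clusterSize ((a , b) ∷ []))
      ≡⟨ avg-cong (All.map (λ { {S} (sk , _) → trans (SingleEdge.size-componentsMeeting-single a b ab S) (cong₂ _+_ (cong fromℕ sk) (ind-xor (lookup S a) (lookup S b))) }) allL) ⟩
    avg (λ S → fromℕ k + (ind (lookup S a) + ind (lookup S b) - two * ind (lookup S a ∧ lookup S b)))
      ≡⟨ avg-+ (λ _ → fromℕ k) _ ⟩
    avg (λ _ → fromℕ k) + avg (λ S → ind (lookup S a) + ind (lookup S b) - two * ind (lookup S a ∧ lookup S b))
      ≡⟨ cong₂ _+_ (avg-const (fromℕ k)) (trans (avg-+ _ _) (cong₂ _+_ (avg-+ _ _) (trans (avg-neg _) (cong -_ (avg-*ˡ two _))))) ⟩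
    fromℕ k + (inclusion a + inclusion b - two * pairInclusion a b) ∎
    where
    open ≡-Reasoning

  inclusion≡ : ∀ k1 r1 → k ≡ suc k1 → r ≡ suc r1 → ∀ v → inclusion v ≡ ind (lookup X v) * (fromℕ k * frac 1 r)
  inclusion≡ k1 r1 refl refl v = *-cancelʳ-fromℕ-suc r1 (trans (inclusion*r≡ k1 r1 refl refl v)
    (trans (solve 4 (λ b k f r → b :* k := b :* (k :* con 1ℚ)) refl (ind (lookup X v)) (fromℕ k) (frac 1 r) (fromℕ r))
      (trans (cong (λ z → ind (lookup X v) * (fromℕ k * z)) (sym (frac*den≡num 1 r1))) (solve 4 (λ b k f r → b :* (k :* (f :* r)) := b :* (k :* f) :* r) refl (ind (lookup X v)) (fromℕ k) (frac 1 r) (fromℕ r)))))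

  pairInclusion≡ : ∀ k2 r2 → k ≡ suc (suc k2) → r ≡ suc (suc r2) → ∀ i j → ¬ i ≡ j →
    pairInclusion i j ≡ ind (lookup X i ∧ lookup X j) * (fromℕ k * fromℕ (suc k2) * (frac 1 r * frac 1 (suc r2)))
  pairInclusion≡ k2 r2 refl refl i j ne = *-cancelʳ-fromℕ-suc (suc r2) (*-cancelʳ-fromℕ-suc r2 (trans (trans (QP.*-assoc (pairInclusion i j) (fromℕ r) (fromℕ (suc r2))) (pairInclusion*rr≡ k2 r2 refl refl i j ne))
    (sym (trans (solve 7 (λ b k k' f f' r r' → b :* (k :* k' :* (f :* f')) :* r :* r' := b :* (k :* k') :* (f :* r) :* (f' :* r')) refl
         (ind (lookup X i ∧ lookup X j)) (fromℕ k) (fromℕ (suc k2)) (frac 1 r) (frac 1 (suc r2)) (fromℕ r) (fromℕ (suc r2)))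
      (trans (cong₂ (λ u v → ind (lookup X i ∧ lookup X j) * (fromℕ k * fromℕ (suc k2)) * u * v) (frac*den≡num 1 (suc r2)) (frac*den≡num 1 r2))
        (solve 2 (λ b c → b :* c :* con 1ℚ :* con 1ℚ := b :* c) refl (ind (lookup X i ∧ lookup X j)) (fromℕ k * fromℕ (suc k2))))))))

module FirstOrder {n : ℕ} (G : Graph n) (k2 r2 : ℕ) (X : Subset n) (hr : ∣ X ∣ ≡ suc (suc r2)) (kr : k2 ℕ.≤ r2) where
  k : ℕ
  k = suc (suc k2)
  r : ℕ
  r = suc (suc r2)
  open UniformKSubsets k X r hr (ℕ.s≤s (ℕ.s≤s kr))
  E : List (Edge n)
  E = edges G
  PX QX DX EX : ℚ
  PX = fromℕ k * frac 1 r
  QX = fromℕ k * fromℕ (suc k2) * (frac 1 r * frac 1 (suc r2))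
  DX = Σ E (λ e → ind (lookup X (proj₁ e)) + ind (lookup X (proj₂ e)))
  EX = Σ E (λ e → ind (lookup X (proj₁ e) ∧ lookup X (proj₂ e)))
  -- One kept edge uv enlarges the cluster of S exactly when one of u, v is a seed.
  edgeGain : Edge n → ℚ
  edgeGain e = inclusion (proj₁ e) + inclusion (proj₂ e) - two * pairInclusion (proj₁ e) (proj₂ e)

  sum-edgeGain : Σ E edgeGain ≡ PX * DX - (two * QX) * EX
  sum-edgeGain = trans (sum-congAll (All.map pw (edges-IsEdge G)))
     (trans (sum-- E _ _) (cong₂ _-_ (sum-*ˡ E PX _) (sum-*ˡ E (two * QX) _)))
    where
    pw : ∀ {e} → IsEdge G e → edgeGain e ≡ PX * (ind (lookup X (proj₁ e)) + ind (lookup X (proj₂ e))) - (two * QX) * ind (lookup X (proj₁ e) ∧ lookup X (proj₂ e))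
    pw {a , b} ok = trans (cong₂ (λ u v → u - two * v) (cong₂ _+_ (inclusion≡ (suc k2) (suc r2) refl refl a) (inclusion≡ (suc k2) (suc r2) refl refl b)) (pairInclusion≡ k2 r2 refl refl a b (edge-ends-distinct G ok)))
      (solve 6 (λ x y z P Q t → x :* P :+ y :* P :- t :* (z :* Q) := P :* (x :+ y) :- (t :* Q) :* z) refl
        (ind (lookup X a)) (ind (lookup X b)) (ind (lookup X a ∧ lookup X b)) PX QX two)

  DX≡ : DX ≡ fromℕ (sumℕ (map (λ v → if lookup X v then deg G v else 0) (allFin n)))
  DX≡ = trans (handshake G (λ v → ind (lookup X v))) (trans (sum-cong (allFin n) pw) (sym (sumℕ-cast (allFin n) (λ v → if lookup X v then deg G v else 0))))
    where
    pw : ∀ v → ind (lookup X v) * fromℕ (deg G v) ≡ fromℕ (if lookup X v then deg G v else 0)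
    pw v with lookup X v
    ... | true = QP.*-identityˡ (fromℕ (deg G v))
    ... | false = QP.*-zeroˡ (fromℕ (deg G v))

  avgDeg≡ : avgDeg G X ≡ DX * frac 1 r
  avgDeg≡ = trans (cong (frac Dn) hr) (trans (frac≡num*frac1 Dn (suc r2)) (cong (_* frac 1 r) (sym DX≡)))
    where Dn = sumℕ (map (λ v → if lookup X v then deg G v else 0) (allFin n))

  PQ : PX - QX ≡ fromℕ k * frac (r2 ℕ.∸ k2) (suc r2) * frac 1 r
  PQ = *-cancelʳ-fromℕ-suc r2 (*-cancelʳ-fromℕ-suc (suc r2) (trans lhs (sym rhs)))
    where
    ιr1 : fromℕ (suc r2) ≡ fromℕ (suc k2) + fromℕ (r2 ℕ.∸ k2)
    ιr1 = trans (cong fromℕ (sym (ℕP.m+[n∸m]≡n (ℕ.s≤s kr)))) (fromℕ-+ (suc k2) (suc r2 ℕ.∸ suc k2))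
    lhs : (PX - QX) * fromℕ (suc r2) * fromℕ r ≡ fromℕ k * fromℕ (r2 ℕ.∸ k2)
    lhs = begin
      (PX - QX) * fromℕ (suc r2) * fromℕ r
        ≡⟨ solve 6 (λ K K' f f' R R' → (K :* f :- K :* K' :* (f :* f')) :* R' :* R := K :* R' :* (f :* R) :- K :* K' :* (f :* R) :* (f' :* R')) refl
             (fromℕ k) (fromℕ (suc k2)) (frac 1 r) (frac 1 (suc r2)) (fromℕ r) (fromℕ (suc r2)) ⟩
      fromℕ k * fromℕ (suc r2) * (frac 1 r * fromℕ r) - fromℕ k * fromℕ (suc k2) * (frac 1 r * fromℕ r) * (frac 1 (suc r2) * fromℕ (suc r2))
        ≡⟨ cong₂ (λ u v → fromℕ k * fromℕ (suc r2) * u - fromℕ k * fromℕ (suc k2) * u * v) (frac*den≡num 1 (suc r2)) (frac*den≡num 1 r2) ⟩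
      fromℕ k * fromℕ (suc r2) * 1ℚ - fromℕ k * fromℕ (suc k2) * 1ℚ * 1ℚ
        ≡⟨ cong (λ z → fromℕ k * z * 1ℚ - fromℕ k * fromℕ (suc k2) * 1ℚ * 1ℚ) ιr1 ⟩
      fromℕ k * (fromℕ (suc k2) + fromℕ (r2 ℕ.∸ k2)) * 1ℚ - fromℕ k * fromℕ (suc k2) * 1ℚ * 1ℚ
        ≡⟨ solve 3 (λ K a b → K :* (a :+ b) :* con 1ℚ :- K :* a :* con 1ℚ :* con 1ℚ := K :* b) refl (fromℕ k) (fromℕ (suc k2)) (fromℕ (r2 ℕ.∸ k2)) ⟩
      fromℕ k * fromℕ (r2 ℕ.∸ k2) ∎
      where open ≡-Reasoning
    rhs : fromℕ k * frac (r2 ℕ.∸ k2) (suc r2) * frac 1 r * fromℕ (suc r2) * fromℕ r ≡ fromℕ k * fromℕ (r2 ℕ.∸ k2)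
    rhs = begin
      fromℕ k * frac (r2 ℕ.∸ k2) (suc r2) * frac 1 r * fromℕ (suc r2) * fromℕ r
        ≡⟨ solve 5 (λ K a f R' R → K :* a :* f :* R' :* R := K :* (a :* R') :* (f :* R)) refl (fromℕ k) (frac (r2 ℕ.∸ k2) (suc r2)) (frac 1 r) (fromℕ (suc r2)) (fromℕ r) ⟩
      fromℕ k * (frac (r2 ℕ.∸ k2) (suc r2) * fromℕ (suc r2)) * (frac 1 r * fromℕ r)
        ≡⟨ cong₂ (λ u v → fromℕ k * u * v) (frac*den≡num (r2 ℕ.∸ k2) r2) (frac*den≡num 1 (suc r2)) ⟩
      fromℕ k * fromℕ (r2 ℕ.∸ k2) * 1ℚ ≡⟨ QP.*-identityʳ _ ⟩
      fromℕ k * fromℕ (r2 ℕ.∸ k2) ∎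
      where open ≡-Reasoning

  sum-edgeGain≡ : Σ E edgeGain ≡ fromℕ k * (frac (r2 ℕ.∸ k2) (suc r2) * avgDeg G X) + QX * (DX - two * EX)
  sum-edgeGain≡ = trans sum-edgeGain (trans (solve 5 (λ P Q D Ex t → P :* D :- (t :* Q) :* Ex := (P :- Q) :* D :+ Q :* (D :- t :* Ex)) refl PX QX DX EX two)
    (cong₂ _+_ (trans (cong (_* DX) PQ) (trans (solve 4 (λ K a f D → K :* a :* f :* D := K :* (a :* (D :* f))) refl (fromℕ k) (frac (r2 ℕ.∸ k2) (suc r2)) (frac 1 r) DX)
      (cong (λ z → fromℕ k * (frac (r2 ℕ.∸ k2) (suc r2) * z)) (sym avgDeg≡)))) refl))

  QX≥0 : 0ℚ Q.≤ QX
  QX≥0 = *-nonneg (*-nonneg (fromℕ-nonneg k) (fromℕ-nonneg (suc k2))) (*-nonneg (frac-nonneg 1 r) (frac-nonneg 1 (suc r2)))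

  -- DX - 2 EX counts the edges leaving X.
  defect≥0 : 0ℚ Q.≤ QX * (DX - two * EX)
  defect≥0 = *-nonneg QX≥0 (subst (0ℚ Q.≤_) (trans (sum-- E Ae (λ e → two * Be e)) (cong (λ z → DX - z) (sum-*ˡ E two Be))) (sum-nonneg (All.universal (λ e → pw (lookup X (proj₁ e)) (lookup X (proj₂ e))) E)))
    where
    Ae Be : Edge n → ℚ
    Ae e = ind (lookup X (proj₁ e)) + ind (lookup X (proj₂ e))
    Be e = ind (lookup X (proj₁ e) ∧ lookup X (proj₂ e))
    pw : ∀ x y → 0ℚ Q.≤ (ind x + ind y) - two * ind (x ∧ y)
    pw true true = QP.≤-refl
    pw true false = QP.<⇒≤ (fromℕ-suc-pos 0)
    pw false true = QP.<⇒≤ (fromℕ-suc-pos 0)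
    pw false false = QP.≤-refl

  defect-⊤ : X ≡ ⊤ → DX - two * EX ≡ 0ℚ
  defect-⊤ refl = trans (cong (λ z → DX - z) (sym (sum-*ˡ E two Be))) (trans (sym (sum-- E Ae (λ e → two * Be e))) (trans (sum-cong E pw) (sum-0 E)))
    where
    Ae Be : Edge n → ℚ
    Ae e = ind (lookup ⊤ (proj₁ e)) + ind (lookup ⊤ (proj₂ e))
    Be e = ind (lookup ⊤ (proj₁ e) ∧ lookup ⊤ (proj₂ e))
    pw : ∀ e → (ind (lookup ⊤ (proj₁ e)) + ind (lookup ⊤ (proj₂ e))) - two * ind (lookup ⊤ (proj₁ e) ∧ lookup ⊤ (proj₂ e)) ≡ 0ℚ
    pw (a , b) rewrite VP.lookup-replicate a true | VP.lookup-replicate b true = refl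

module FewLostAverage {n : ℕ} (G : Graph n) (d : ℕ) (P* : Property* G d) (conn : Connected G)
          (k2 r : ℕ) (X : Subset n) (hr : ∣ X ∣ ≡ r) (k≤r : suc (suc k2) ℕ.≤ r) where
  k : ℕ
  k = suc (suc k2)
  open UniformKSubsets k X r hr k≤r
  E = edges G

  ind-not-∧-not : ∀ a b → ind (not (a ∧ not b)) ≡ 1ℚ - ind a * (1ℚ - ind b)
  ind-not-∧-not true true = refl
  ind-not-∧-not true false = refl
  ind-not-∧-not false true = refl
  ind-not-∧-not false false = refl

  avgSize-few-lost : ∀ c → ConfigOf E c → LostBound E c → Config.nLost c ℕ.≤ d →
    avgSize k X (Config.kept c) ≡ ΣV n (λ v → 1ℚ - ind (isolated (Config.kept c) v) * (1ℚ - inclusion v))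
  avgSize-few-lost c vc cc nl = begin
    avg (clusterSize K)
      ≡⟨ avg-cong (All.map (λ { {S} (sk , _) → trans (∣∣≡Σind-ext (componentsMeeting K S) (λ v → not (isolated K v ∧ not (lookup S v)))
             (FewLostEdges.componentsMeeting-few-lost G d P* conn c vc cc nl S (ℕP.≤-trans (ℕ.s≤s (ℕ.s≤s ℕ.z≤n)) (ℕP.≤-reflexive (sym sk)))))
             (sum-cong (allFin n) (λ v → ind-not-∧-not (isolated K v) (lookup S v))) }) allL) ⟩
    avg (λ S → ΣV n (λ v → 1ℚ - I v * (1ℚ - ind (lookup S v))))
      ≡⟨ cong (_* inv) (sum-swap Ls (allFin n) (λ S v → 1ℚ - I v * (1ℚ - ind (lookup S v)))) ⟩
    ΣV n (λ v → Σ Ls (λ S → 1ℚ - I v * (1ℚ - ind (lookup S v)))) * inv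
      ≡⟨ sym (sum-*ʳ (allFin n) inv (λ v → Σ Ls (λ S → 1ℚ - I v * (1ℚ - ind (lookup S v))))) ⟩
    ΣV n (λ v → avg (λ S → 1ℚ - I v * (1ℚ - ind (lookup S v))))
      ≡⟨ sum-cong (allFin n) pt ⟩
    ΣV n (λ v → 1ℚ - I v * (1ℚ - inclusion v)) ∎
    where
    open ≡-Reasoning
    K = Config.kept c
    I : Fin n → ℚ
    I v = ind (isolated K v)
    pt : ∀ v → avg (λ S → 1ℚ - I v * (1ℚ - ind (lookup S v))) ≡ 1ℚ - I v * (1ℚ - inclusion v)
    pt v = trans (avg-+ (λ _ → 1ℚ) (λ S → - (I v * (1ℚ - ind (lookup S v)))))
      (cong₂ _+_ (avg-const 1ℚ) (trans (avg-neg (λ S → I v * (1ℚ - ind (lookup S v))))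
        (cong -_ (trans (avg-*ˡ (I v) (λ S → 1ℚ - ind (lookup S v)))
          (cong (I v *_) (trans (avg-+ (λ _ → 1ℚ) (λ S → - ind (lookup S v))) (cong₂ _+_ (avg-const 1ℚ) (avg-neg (λ S → ind (lookup S v))))))))))

diff-bounds : ∀ {a b N : ℚ} → 0ℚ Q.≤ a → a Q.≤ N → 0ℚ Q.≤ b → b Q.≤ N → - N Q.≤ a - b × a - b Q.≤ N
diff-bounds {a} {b} {N} a0 aN b0 bN =
  0≤q-p⇒p≤q (subst (0ℚ Q.≤_) (solve 3 (λ a b N → (a :+ (N :- b)) := a :- b :- (:- N)) refl a b N) (+-nonneg a0 (p≤q⇒0≤q-p bN))) ,
  0≤q-p⇒p≤q (subst (0ℚ Q.≤_) (solve 3 (λ a b N → (N :- a) :+ b := N :- (a :- b)) refl a b N) (+-nonneg (p≤q⇒0≤q-p aN) b0))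

neg-bounds : ∀ {a N : ℚ} → - N Q.≤ a × a Q.≤ N → - N Q.≤ - a × - a Q.≤ N
neg-bounds {a} {N} (l , u) = QP.neg-antimono-≤ u , subst (- a Q.≤_) (solve 1 (λ N → :- (:- N) := N) refl N) (QP.neg-antimono-≤ l)

≡ᵇ≡⌊≟⌋ : ∀ d m → (d ≡ᵇ m) ≡ ⌊ m ℕP.≟ d ⌋
≡ᵇ≡⌊≟⌋ d m with m ℕP.≟ d
... | yes refl = ≡ᵇ-refl d
... | no ne = ≢⇒≡ᵇ≡false (λ e → ne (sym e))

if-≡ᵇ-cong : ∀ {m d} {x y : ℚ} → (m ≡ d → x ≡ y) → (if m ≡ᵇ d then x else 0ℚ) ≡ (if m ≡ᵇ d then y else 0ℚ)
if-≡ᵇ-cong {m} {d} h with m ≡ᵇ d in eq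
... | true = h (ℕP.≡ᵇ⇒≡ m d (subst T (sym eq) _))
... | false = refl

if-Σ : ∀ {A : Set} b (xs : List A) (f g : A → ℚ) → (if b then Σ xs (λ x → f x * g x) else 0ℚ) ≡ Σ xs (λ x → (if b then f x else 0ℚ) * g x)
if-Σ true xs f g = refl
if-Σ false xs f g = sym (trans (sum-cong xs (λ x → QP.*-zeroˡ (g x))) (sum-0 xs))

ind-∧ : ∀ a b → ind (a ∧ b) ≡ ind a * ind b
ind-∧ true true = refl
ind-∧ true false = refl
ind-∧ false true = refl
ind-∧ false false = refl

length≡0⇒[] : ∀ {A : Set} (K : List A) → length K ≡ 0 → K ≡ []
length≡0⇒[] [] _ = refl

suc-suc-view : ∀ m → 2 ℕ.≤ m → ∃ λ m′ → m ≡ suc (suc m′)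
suc-suc-view zero ()
suc-suc-view (suc zero) (ℕ.s≤s ())
suc-suc-view (suc (suc m)) _ = m , refl

seed-sizes : ∀ {n} (C : Subset n) k2 → suc (suc k2) ℕ.< ∣ C ∣ →
  ∃ λ r2 → ∃ λ n2 → ∣ C ∣ ≡ suc (suc r2) × n ≡ suc (suc n2) × k2 ℕ.≤ r2 × k2 ℕ.≤ n2
seed-sizes {n} C k2 k<C = r2 , n2 , hC , hn , ℕP.<⇒≤ k2<r2 , ℕP.<⇒≤ (ℕP.<-≤-trans k2<r2 r2≤n2)
  where
  two≤C : 2 ℕ.≤ ∣ C ∣
  two≤C = ℕP.≤-trans (ℕ.s≤s (ℕ.s≤s ℕ.z≤n)) (ℕP.<⇒≤ k<C)
  r2 n2 : ℕ
  r2 = proj₁ (suc-suc-view ∣ C ∣ two≤C)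
  n2 = proj₁ (suc-suc-view n (ℕP.≤-trans two≤C (∣p∣≤n C)))
  hC : ∣ C ∣ ≡ suc (suc r2)
  hC = proj₂ (suc-suc-view ∣ C ∣ two≤C)
  hn : n ≡ suc (suc n2)
  hn = proj₂ (suc-suc-view n (ℕP.≤-trans two≤C (∣p∣≤n C)))
  k2<r2 : k2 ℕ.< r2
  k2<r2 = ℕP.≤-pred (ℕP.≤-pred (subst (suc (suc (suc k2)) ℕ.≤_) hC k<C))
  r2≤n2 : r2 ℕ.≤ n2
  r2≤n2 = ℕP.≤-pred (ℕP.≤-pred (subst₂ ℕ._≤_ hC hn (∣p∣≤n C)))

module SizeGapExpansion {n : ℕ} (G : Graph n) (C : Subset n) (k2 r2 n2 : ℕ)
    (hC : ∣ C ∣ ≡ suc (suc r2)) (hn : n ≡ suc (suc n2)) (k2≤r2 : k2 ℕ.≤ r2) (k2≤n2 : k2 ℕ.≤ n2) where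
  k r : ℕ
  k = suc (suc k2)
  r = suc (suc r2)
  hV : ∣ ⊤ {n} ∣ ≡ suc (suc n2)
  hV = trans (∣⊤∣≡n n) hn
  E : List (Edge n)
  E = edges G
  module MC = UniformKSubsets k C r hC (ℕ.s≤s (ℕ.s≤s k2≤r2))
  module MV = UniformKSubsets k (⊤ {n}) (suc (suc n2)) hV (ℕ.s≤s (ℕ.s≤s k2≤n2))

  terms : List Term
  terms = map (λ c → (Config.nKept c , Config.nLost c , sizeGap k C (Config.kept c))) (configs E)

  gap≡Σterms : ∀ β → expectedSize G β k C - expectedSize G β k ⊤ ≡ Σ terms (evalTerm β)
  gap≡Σterms β = trans (expectedSize-gap G β k C) (sym (sum-map (configs E) _ (evalTerm β)))

  terms-xExp≤ : All (λ t → xExp t ℕ.≤ length E) terms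
  terms-xExp≤ = map⁺ (All.map (λ { (v1 , _) → ℕP.≤-trans (ℕP.m≤m+n _ _) (ℕP.≤-reflexive v1) }) (configs-ConfigOf E))

  terms-yExp≤ : All (λ t → yExp t ℕ.≤ length E) terms
  terms-yExp≤ = map⁺ (All.map (λ { (v1 , _) → ℕP.≤-trans (ℕP.m≤n+m _ _) (ℕP.≤-reflexive v1) }) (configs-ConfigOf E))

  terms-bounded : All (λ t → - fromℕ n Q.≤ coeff t × coeff t Q.≤ fromℕ n) terms
  terms-bounded = map⁺ (All.universal (λ c → gap-bounds (Config.kept c)) (configs E))
    where
    gap-bounds : ∀ K → - fromℕ n Q.≤ sizeGap k C K × sizeGap k C K Q.≤ fromℕ n
    gap-bounds K = diff-bounds (proj₁ (MC.avgSize-bounds K)) (proj₂ (MC.avgSize-bounds K)) (proj₁ (MV.avgSize-bounds K)) (proj₂ (MV.avgSize-bounds K))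

  terms-vanish-at-0 : All (λ t → xExp t ℕ.< 1 → coeff t ≡ 0ℚ) terms
  terms-vanish-at-0 = map⁺ (All.map (λ { {c} (_ , v2 , _) (ℕ.s≤s ℕ.z≤n) →
    trans (cong (sizeGap k C) (length≡0⇒[] (Config.kept c) v2)) (trans (cong₂ _-_ MC.avgSize-[] MV.avgSize-[]) (QP.+-inverseʳ (fromℕ k))) }) (configs-ConfigOf E))

  module FC = FirstOrder G k2 r2 C hC k2≤r2
  module FV = FirstOrder G k2 n2 (⊤ {n}) hV k2≤n2

  coeff₁≡ : Σ terms (coeffAt 1) ≡ Σ E FC.edgeGain - Σ E FV.edgeGain
  coeff₁≡ = trans (sum-map (configs E) _ (coeffAt 1)) (trans (sum-nKept≡1 E (sizeGap k C)) (trans (sum-congAll (All.map pw (edges-IsEdge G))) (sum-- E FC.edgeGain FV.edgeGain)))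
    where
    pw : ∀ {e} → IsEdge G e → sizeGap k C (e ∷ []) ≡ FC.edgeGain e - FV.edgeGain e
    pw {a , b} ok = trans (cong₂ _-_ (MC.avgSize-single a b (edge-ends-distinct G ok)) (MV.avgSize-single a b (edge-ends-distinct G ok)))
      (solve 3 (λ K x y → (K :+ x) :- (K :+ y) := x :- y) refl (fromℕ k) (FC.edgeGain (a , b)) (FV.edgeGain (a , b)))

  coeff₁-pos : frac (n ℕ.∸ k) (n ℕ.∸ 1) * avgDeg G ⊤ Q.< frac (∣ C ∣ ℕ.∸ k) (∣ C ∣ ℕ.∸ 1) * avgDeg G C →
    0ℚ Q.< Σ terms (coeffAt 1)
  coeff₁-pos hyp = subst (0ℚ Q.<_) (sym (trans coeff₁≡ (cong₂ _-_ FC.sum-edgeGain≡ (trans FV.sum-edgeGain≡ (trans (cong (λ z → AV + FV.QX * z) (FV.defect-⊤ refl)) (cong (AV +_) (QP.*-zeroʳ FV.QX)))))))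
    (subst (0ℚ Q.<_) (solve 4 (λ K a b rc → K :* (b :- a) :+ rc := (K :* b :+ rc) :- (K :* a :+ con 0ℚ)) refl (fromℕ k) (frac (n2 ℕ.∸ k2) (suc n2) * avgDeg G ⊤) (frac (r2 ℕ.∸ k2) (suc r2) * avgDeg G C) (FC.QX * (FC.DX - MC.two * FC.EX)))
      (QP.+-mono-<-≤ (*-pos (fromℕ-suc-pos (suc k2)) (p<q⇒0<q-p hyp′)) FC.defect≥0))
    where
    hyp′ : frac (n2 ℕ.∸ k2) (suc n2) * avgDeg G ⊤ Q.< frac (r2 ℕ.∸ k2) (suc r2) * avgDeg G C
    hyp′ = subst₂ (λ N R → frac (N ℕ.∸ k) (N ℕ.∸ 1) * avgDeg G ⊤ Q.< frac (R ℕ.∸ k) (R ℕ.∸ 1) * avgDeg G C) hn hC hyp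
    AV : ℚ
    AV = fromℕ k * (frac (n2 ℕ.∸ k2) (suc n2) * avgDeg G ⊤)

  module LowLossCoefficient (conn : Connected G) (d : ℕ) (P* : Property* G d) where
    module LC = FewLostAverage G d P* conn k2 r C hC (ℕ.s≤s (ℕ.s≤s k2≤r2))
    module LV = FewLostAverage G d P* conn k2 (suc (suc n2)) (⊤ {n}) hV (ℕ.s≤s (ℕ.s≤s k2≤n2))

    I : List (Edge n) → Fin n → ℚ
    I K v = ind (isolated K v)

    WellFormed : Config n → Set₁
    WellFormed c = ConfigOf E c × LostBound E c

    configs-WellFormed : All WellFormed (configs E)
    configs-WellFormed = All.zip (configs-ConfigOf E , configs-LostBound E)

    sizeGap-few-lost : ∀ c → WellFormed c → Config.nLost c ℕ.≤ d →
      sizeGap k C (Config.kept c) ≡ ΣV n (λ v → I (Config.kept c) v * (MC.inclusion v - MV.inclusion v))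
    sizeGap-few-lost c (vc , cc) nl = trans (cong₂ _-_ (LC.avgSize-few-lost c vc cc nl) (LV.avgSize-few-lost c vc cc nl))
      (trans (sym (sum-- (allFin n) _ _)) (sum-cong (allFin n) (λ v → solve 3 (λ i a b → (con 1ℚ :- i :* (con 1ℚ :- a)) :- (con 1ℚ :- i :* (con 1ℚ :- b)) := i :* (a :- b)) refl (I (Config.kept c) v) (MC.inclusion v) (MV.inclusion v))))

    mindeg : ∀ v → d ℕ.≤ deg G v
    mindeg = proj₂ (proj₁ P*)

    sizeGap-fewer-lost : ∀ c → WellFormed c → Config.nLost c ℕ.< d → sizeGap k C (Config.kept c) ≡ 0ℚ
    sizeGap-fewer-lost c (vc , cc) lt = trans (sizeGap-few-lost c (vc , cc) (ℕP.<⇒≤ lt)) (trans (sum-cong (allFin n) none-isolated) (sum-0 (allFin n)))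
      where
      none-isolated : ∀ v → I (Config.kept c) v * (MC.inclusion v - MV.inclusion v) ≡ 0ℚ
      none-isolated v with isolated (Config.kept c) v in iv
      ... | false = QP.*-zeroˡ (MC.inclusion v - MV.inclusion v)
      ... | true = ⊥-elim (ℕP.<-irrefl refl (ℕP.<-≤-trans lt (ℕP.≤-trans (mindeg v) (isolated⇒deg≤nLost G c cc v iv))))

    lowTerms : List Term
    lowTerms = map mirror terms

    gap≡Σlow : ∀ β → expectedSize G β k ⊤ - expectedSize G β k C ≡ Σ lowTerms (evalTerm (1ℚ - β))
    gap≡Σlow β = sym (begin
      Σ lowTerms (evalTerm (1ℚ - β)) ≡⟨ sum-map terms mirror (evalTerm (1ℚ - β)) ⟩
      Σ terms (λ t → evalTerm (1ℚ - β) (mirror t)) ≡⟨ sum-cong terms (evalTerm-mirror β) ⟩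
      Σ terms (λ t → - evalTerm β t) ≡⟨ sum-neg terms (evalTerm β) ⟩
      - Σ terms (evalTerm β) ≡⟨ cong -_ (sym (gap≡Σterms β)) ⟩
      - (expectedSize G β k C - expectedSize G β k ⊤) ≡⟨ solve 2 (λ a b → :- (a :- b) := b :- a) refl (expectedSize G β k C) (expectedSize G β k ⊤) ⟩
      expectedSize G β k ⊤ - expectedSize G β k C ∎)
      where open ≡-Reasoning

    lowTerms-yExp≤ : All (λ t → yExp t ℕ.≤ length E) lowTerms
    lowTerms-yExp≤ = map⁺ terms-xExp≤

    lowTerms-bounded : All (λ t → - fromℕ n Q.≤ coeff t × coeff t Q.≤ fromℕ n) lowTerms
    lowTerms-bounded = map⁺ (All.map neg-bounds terms-bounded)

    lowTerms-vanish-below : All (λ t → xExp t ℕ.< d → coeff t ≡ 0ℚ) lowTerms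
    lowTerms-vanish-below = map⁺ (map⁺ (All.map (λ {c} wf lt → cong -_ (sizeGap-fewer-lost c wf lt)) configs-WellFormed))

    Y : Subset n
    Y = minDegSet G d

    coeff-d≡ : Σ lowTerms (coeffAt d) ≡ fromℕ k * (frac (∣ Y ∣) (suc (suc n2)) - frac (∣ Y ∩ C ∣) r)
    coeff-d≡ = begin
      Σ lowTerms (coeffAt d) ≡⟨ trans (sum-map terms mirror (coeffAt d)) (sum-map (configs E) _ _) ⟩
      Σ (configs E) (λ c → if Config.nLost c ≡ᵇ d then - sizeGap k C (Config.kept c) else 0ℚ) ≡⟨ sum-congAll (All.map (λ {c} → per-config c) configs-WellFormed) ⟩
      Σ (configs E) (λ c → ΣV n (λ v → A c v * h v)) ≡⟨ sum-swap (configs E) (allFin n) (λ c v → A c v * h v) ⟩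
      ΣV n (λ v → Σ (configs E) (λ c → A c v * h v)) ≡⟨ sum-cong (allFin n) (λ v → trans (sum-*ʳ (configs E) (h v) (λ c → A c v)) (cong (_* h v) (Σ-isolated-after-d-losses v))) ⟩
      ΣV n (λ v → ind ⌊ deg G v ℕP.≟ d ⌋ * h v) ≡⟨ sum-cong (allFin n) (λ v → cong (λ z → ind ⌊ deg G v ℕP.≟ d ⌋ * z) (cong₂ _-_ (pV≡ v) (pC≡ v))) ⟩
      ΣV n (λ v → ind ⌊ deg G v ℕP.≟ d ⌋ * (PV - ind (lookup C v) * PC))
        ≡⟨ sum-cong (allFin n) (λ v → solve 4 (λ y c P Q → y :* (P :- c :* Q) := P :* y :- Q :* (y :* c)) refl (ind ⌊ deg G v ℕP.≟ d ⌋) (ind (lookup C v)) PV PC) ⟩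
      ΣV n (λ v → PV * ind ⌊ deg G v ℕP.≟ d ⌋ - PC * (ind ⌊ deg G v ℕP.≟ d ⌋ * ind (lookup C v)))
        ≡⟨ trans (sum-- (allFin n) _ _) (cong₂ _-_ (sum-*ˡ (allFin n) PV _) (sum-*ˡ (allFin n) PC _)) ⟩
      PV * ΣV n (λ v → ind ⌊ deg G v ℕP.≟ d ⌋) - PC * ΣV n (λ v → ind ⌊ deg G v ℕP.≟ d ⌋ * ind (lookup C v))
        ≡⟨ cong₂ (λ u w → PV * u - PC * w) (sym cardY) (sym cardYC) ⟩
      PV * fromℕ (∣ Y ∣) - PC * fromℕ (∣ Y ∩ C ∣)
        ≡⟨ solve 5 (λ K f g a b → K :* f :* a :- K :* g :* b := K :* (a :* f :- b :* g)) refl (fromℕ k) (frac 1 (suc (suc n2))) (frac 1 r) (fromℕ (∣ Y ∣)) (fromℕ (∣ Y ∩ C ∣)) ⟩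
      fromℕ k * (fromℕ (∣ Y ∣) * frac 1 (suc (suc n2)) - fromℕ (∣ Y ∩ C ∣) * frac 1 r)
        ≡⟨ sym (cong₂ (λ u w → fromℕ k * (u - w)) (frac≡num*frac1 (∣ Y ∣) (suc n2)) (frac≡num*frac1 (∣ Y ∩ C ∣) (suc r2))) ⟩
      fromℕ k * (frac (∣ Y ∣) (suc (suc n2)) - frac (∣ Y ∩ C ∣) r) ∎
      where
      open ≡-Reasoning
      h : Fin n → ℚ
      h v = MV.inclusion v - MC.inclusion v
      A : Config n → Fin n → ℚ
      A c v = if Config.nLost c ≡ᵇ d then I (Config.kept c) v else 0ℚ
      per-config : ∀ c → WellFormed c → (if Config.nLost c ≡ᵇ d then - sizeGap k C (Config.kept c) else 0ℚ) ≡ ΣV n (λ v → A c v * h v)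
      per-config c wf = trans (if-≡ᵇ-cong (λ nl≡d → trans (cong -_ (sizeGap-few-lost c wf (ℕP.≤-reflexive nl≡d)))
          (trans (sym (sum-neg (allFin n) _)) (sum-cong (allFin n) (λ v → solve 3 (λ i a b → :- (i :* (a :- b)) := i :* (b :- a)) refl (I (Config.kept c) v) (MC.inclusion v) (MV.inclusion v))))))
        (if-Σ (Config.nLost c ≡ᵇ d) (allFin n) (I (Config.kept c)) h)
      Σ-isolated-after-d-losses : ∀ v → Σ (configs E) (λ c → A c v) ≡ ind ⌊ deg G v ℕP.≟ d ⌋
      Σ-isolated-after-d-losses v = trans (sum-nLost≡-avoiding (incident v) E d (subst (d ℕ.≤_) (sym (incident-count≡deg G v)) (mindeg v)))
        (trans (cong (λ m → if d ≡ᵇ m then 1ℚ else 0ℚ) (incident-count≡deg G v)) (cong ind (≡ᵇ≡⌊≟⌋ d (deg G v))))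
      cardY : fromℕ (∣ Y ∣) ≡ ΣV n (λ v → ind ⌊ deg G v ℕP.≟ d ⌋)
      cardY = ∣∣≡Σind-ext Y _ (λ v → VP.lookup∘tabulate _ v)
      cardYC : fromℕ (∣ Y ∩ C ∣) ≡ ΣV n (λ v → ind ⌊ deg G v ℕP.≟ d ⌋ * ind (lookup C v))
      cardYC = trans (∣∣≡Σind-ext (Y ∩ C) _ (λ v → trans (VP.lookup-zipWith _∧_ v Y C) (cong (_∧ lookup C v) (VP.lookup∘tabulate _ v))))
        (sum-cong (allFin n) (λ v → ind-∧ ⌊ deg G v ℕP.≟ d ⌋ (lookup C v)))
      PV PC : ℚ
      PV = fromℕ k * frac 1 (suc (suc n2))
      PC = fromℕ k * frac 1 r
      pV≡ : ∀ v → MV.inclusion v ≡ PV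
      pV≡ v = trans (MV.inclusion≡ (suc k2) (suc n2) refl refl v) (trans (cong (λ b → ind b * PV) (VP.lookup-replicate v true)) (QP.*-identityˡ PV))
      pC≡ : ∀ v → MC.inclusion v ≡ ind (lookup C v) * PC
      pC≡ v = MC.inclusion≡ (suc k2) (suc r2) refl refl v

    coeff-d-pos : frac (∣ Y ∩ C ∣) (∣ C ∣) Q.< frac (∣ Y ∣) n → 0ℚ Q.< Σ lowTerms (coeffAt d)
    coeff-d-pos hyp = subst (0ℚ Q.<_) (sym coeff-d≡) (*-pos (fromℕ-suc-pos (suc k2)) (p<q⇒0<q-p (subst₂ (λ R N → frac (∣ Y ∩ C ∣) R Q.< frac (∣ Y ∣) N) hC hn hyp)))

theorem2p4a : ∀ {n} (G : Graph n) (C : Subset n) (k : ℕ) → 2 ℕ.≤ k → k ℕ.< ∣ C ∣ →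
    (frac (n ℕ.∸ k) (n ℕ.∸ 1) * avgDeg G ⊤ Q.< frac (∣ C ∣ ℕ.∸ k) (∣ C ∣ ℕ.∸ 1) * avgDeg G C) →
      ∃ λ ε → 0ℚ Q.< ε × (∀ β → 0ℚ Q.< β → β Q.< ε → β Q.≤ 1ℚ →
        expectedSize G β k ⊤ Q.< expectedSize G β k C)
theorem2p4a {n} G C (suc (suc k2)) (ℕ.s≤s (ℕ.s≤s _)) k<C hyp =
  let (r2 , n2 , hC , hn , k2≤r2 , k2≤n2) = seed-sizes C k2 k<C
      open SizeGapExpansion G C k2 r2 n2 hC hn k2≤r2 k2≤n2
      (ε , ε>0 , positive) = positive-near-0 terms 1 (length E) n terms-yExp≤ terms-vanish-at-0 terms-bounded (coeff₁-pos hyp)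
  in ε , ε>0 , λ β 0<β β<ε β≤1 → 0<q-p⇒p<q (subst (0ℚ Q.<_) (sym (gap≡Σterms β)) (positive β 0<β β<ε β≤1))

theorem2p4b : ∀ {n} (G : Graph n) → Connected G → (C : Subset n) (k : ℕ) → 2 ℕ.≤ k → k ℕ.< ∣ C ∣ →
    (∀ (d : ℕ) → Property* G d →
      frac (∣ minDegSet G d ∩ C ∣) (∣ C ∣) Q.< frac (∣ minDegSet G d ∣) n →
      ∃ λ ε → 0ℚ Q.< ε × (∀ β → 0ℚ Q.≤ β → 1ℚ - ε Q.< β → β Q.< 1ℚ →
        expectedSize G β k C Q.< expectedSize G β k ⊤))
theorem2p4b {n} G conn C (suc (suc k2)) (ℕ.s≤s (ℕ.s≤s _)) k<C d P* hyp =
  let (r2 , n2 , hC , hn , k2≤r2 , k2≤n2) = seed-sizes C k2 k<C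
      open SizeGapExpansion G C k2 r2 n2 hC hn k2≤r2 k2≤n2
      open LowLossCoefficient conn d P*
      (ε , ε>0 , positive) = positive-near-0 lowTerms d (length E) n lowTerms-yExp≤ lowTerms-vanish-below lowTerms-bounded (coeff-d-pos hyp)
  in ε , ε>0 , λ β 0≤β 1-ε<β β<1 →
       let (x>0 , x<ε , x≤1) = 1-β-in-range 0≤β 1-ε<β β<1
       in 0<q-p⇒p<q (subst (0ℚ Q.<_) (sym (gap≡Σlow β)) (positive (1ℚ - β) x>0 x<ε x≤1))

open import Data.Nat using (_≤_; _<_)
open import Data.Rational using () renaming (_<_ to _<ℚ_; _≤_ to _≤ℚ_)

theorem2p4 : ∀ (n : ℕ) (G : Graph n) → Connected G →
  (C : Subset n) (k : ℕ) → 2 ≤ k → k < ∣ C ∣ →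
  -- (a)
  ((frac (n ∸ k) (n ∸ 1) * avgDeg G ⊤ <ℚ frac (∣ C ∣ ∸ k) (∣ C ∣ ∸ 1) * avgDeg G C) →
    ∃ λ ε → 0ℚ <ℚ ε × (∀ β → 0ℚ <ℚ β → β <ℚ ε → β ≤ℚ 1ℚ →
      expectedSize G β k ⊤ <ℚ expectedSize G β k C))
  ×
  -- (b)
  (∀ (d : ℕ) → Property* G d →
    frac (∣ minDegSet G d ∩ C ∣) (∣ C ∣) <ℚ frac (∣ minDegSet G d ∣) n →
    ∃ λ ε → 0ℚ <ℚ ε × (∀ β → 0ℚ ≤ℚ β → 1ℚ - ε <ℚ β → β <ℚ 1ℚ →
      expectedSize G β k C <ℚ expectedSize G β k ⊤))
theorem2p4 n G conn C k 2≤k k<C = theorem2p4a G C k 2≤k k<C , theorem2p4b G conn C k 2≤k k<C
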